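{- Let $u_1,u_2,u_3,c\in\mathbb{Z}_3$ with $v_3(c)>0$ and $v_3(u_1u_2u_3)=0$, and consider $u_1X^3+u_2Y^3+u_3Z^3-cXYZ=0$. (1) If $u_i\equiv\pm u_j\pmod 9$ for some $i\neq j$, the cubic has a nontrivial solution in $\mathbb{Q}_3$. (2) If $u_i\not\equiv\pm u_j\pmod9$ for all $i\ne j$ (which implies $u_1u_2u_3\equiv\pm1\pmod 9$), the cubic has a nontrivial solution in $\mathbb{Q}_3$ if and only if there exist $s_1,s_2\in\{ -1,1\}$ such that $c\equiv s_1u_1+s_2u_2+s_1s_2u_3\pmod{27}$. -}

module Defs where

open import Data.Nat using (ℕ; suc) renaming (_^_ to _^ℕ_)
open import Data.Integer using (ℤ; +_; -_; _+_; _-_; _*_; -1ℤ; 1ℤ)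
open import Data.Integer.Divisibility using (_∣_)
open import Data.Fin using (Fin; zero; suc)
open import Data.Product using (Σ; _×_; ∃-syntax)
open import Data.Sum using (_⊎_)
open import Relation.Nullary using (¬_)
open import Relation.Binary.PropositionalEquality using (_≡_; _≢_)

-- The ring ℤ₃ of 3-adic integers, presented as the inverse limit
-- lim ℤ/3^k: a sequence of integers (x_k) with x_{k+1} ≡ x_k (mod 3^k).
-- The represented 3-adic integer x satisfies x ≡ x_k (mod 3^k).
record ℤ₃ : Set where
  field
    seq : ℕ → ℤ
    coh : ∀ k → (+ (3 ^ℕ k)) ∣ (seq (suc k) - seq k)
open ℤ₃ public

IsZero₃ : ℤ₃ → Set
IsZero₃ x = ∀ k → (+ (3 ^ℕ k)) ∣ seq x k

cubicAt : (Fin 3 → ℤ₃) → ℤ₃ → ℤ₃ → ℤ₃ → ℤ₃ → ℕ → ℤ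
cubicAt u c X Y Z k =
  seq (u zero) k * (x * x * x) + seq (u (suc zero)) k * (y * y * y)
    + seq (u (suc (suc zero))) k * (z * z * z) - seq c k * x * y * z
  where
  x = seq X k
  y = seq Y k
  z = seq Z k

IsSolution : (Fin 3 → ℤ₃) → ℤ₃ → ℤ₃ → ℤ₃ → ℤ₃ → Set
IsSolution u c X Y Z = ∀ k → (+ (3 ^ℕ k)) ∣ cubicAt u c X Y Z k

-- The cubic has a nontrivial solution in ℚ₃.  Since the cubic is homogeneous
-- and ℚ₃ = ℤ₃[1/3], this is the existence of a solution in ℤ₃³ ∖ {(0,0,0)}
-- (clear a common denominator 3^n).
HasNontrivialSolution : (Fin 3 → ℤ₃) → ℤ₃ → Set
HasNontrivialSolution u c =
  Σ ℤ₃ λ X → Σ ℤ₃ λ Y → Σ ℤ₃ λ Z →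
    IsSolution u c X Y Z × ¬ (IsZero₃ X × IsZero₃ Y × IsZero₃ Z)

-- u_i ≡ ± u_j (mod 9)  (read off at level 2, since u ≡ u_2 mod 9)
PlusMinusMod9 : (Fin 3 → ℤ₃) → Fin 3 → Fin 3 → Set
PlusMinusMod9 u i j =
  (+ 9) ∣ (seq (u i) 2 - seq (u j) 2) ⊎ (+ 9) ∣ (seq (u i) 2 + seq (u j) 2)

IsSign : ℤ → Set
IsSign s = s ≡ 1ℤ ⊎ s ≡ -1ℤ

SignCondition : (Fin 3 → ℤ₃) → ℤ₃ → Set
SignCondition u c =
  Σ ℤ λ s₁ → Σ ℤ λ s₂ → IsSign s₁ × IsSign s₂ ×
    (+ 27) ∣ (seq c 3 - (s₁ * seq (u zero) 3 + s₂ * seq (u (suc zero)) 3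
                         + s₁ * s₂ * seq (u (suc (suc zero))) 3))

module Submission where

-- Zeros of F = u₁X³ + u₂Y³ + u₃Z³ − cXYZ are produced by Hensel lifting along one coordinate:
-- if 3^(i+2) ∣ F(x₀, y₀, z₀) and ∂F/∂X(x₀, y₀, z₀) has valuation exactly i ≤ 2, then
-- F(x₀ + 3s, y₀, z₀) / 3^(i+1) is a cubic in s with unit linear coefficient, and Newton's
-- iteration converges 3-adically.
-- (1) If u₁ ≡ ∓u₂ (mod 9), a point (1 + 3s, ±1, 0) satisfies this with i = 1.
-- (2) Modulo 27, a zero of F with a unit coordinate has all coordinates ≡ ±1 (mod 3) (this is a
-- finite check modulo 9), and expanding F(e + 3a) gives c ≡ s₁u₁ + s₂u₂ + s₁s₂u₃ (mod 27).
-- Without the sign condition every zero modulo 3^(3m) is therefore divisible by 3^m, so F has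
-- only the trivial 3-adic zero. Conversely, after changing signs, c ≡ u₁ + u₂ + u₃ (mod 27);
-- then 9 divides each 3uᵢ − c = ∂F/∂Xᵢ(1, 1, 1) with quotients distinct modulo 3, and for one
-- coordinate and one s the point (1 + 3s, 1, 1) (permuted) satisfies the lifting condition
-- with i = 2.

open import Defs
open import Data.Integer using (+_; _*_)
open import Data.Integer.Divisibility using (_∣_)
open import Data.Fin using (Fin; zero; suc)
open import Data.Product using (Σ; _×_)
open import Relation.Nullary using (¬_)
open import Relation.Binary.PropositionalEquality using (_≢_)

open import Data.Nat as ℕ using (ℕ; zero; suc; _≤_; s≤s; z≤n) renaming (_^_ to _^ℕ_)
import Data.Nat.Properties as ℕ
open import Data.Integer as ℤ using (ℤ; -_; _+_; _-_; 0ℤ; 1ℤ; -1ℤ)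
import Data.Integer.Properties as ℤ
import Data.Integer.DivMod as ℤ
open import Data.Integer.Tactic.RingSolver using (solve-∀)
open import Data.Integer.Divisibility.Signed as Signed
  using (divides; ∣ᵤ⇒∣; ∣⇒∣ᵤ; _∣?_) renaming (_∣_ to _∣ˢ_)
open import Data.Fin as Fin using (toℕ; fromℕ<)
import Data.Fin.Properties as Fin
open import Data.Product using (_,_; proj₁; proj₂)
open import Data.Sum using (_⊎_; inj₁; inj₂)
import Data.Sum
open import Data.Empty using (⊥-elim)
open import Function using (_∘_; id)
open import Relation.Nullary using (Dec; yes; no; ¬?)
open import Relation.Nullary.Decidable using (toWitness; toWitnessFalse; map′; _×-dec_; _⊎-dec_; _→-dec_)
open import Relation.Binary.PropositionalEquality
  using (_≡_; refl; sym; trans; cong; cong₂; subst; subst₂; module ≡-Reasoning)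

pattern 0F = zero
pattern 1F = suc zero
pattern 2F = suc (suc zero)

infix 4 _≈[_]_
record _≈[_]_ (a n b : ℤ) : Set where
  constructor mk≈
  field ∣-diff : n ∣ˢ (a - b)
open _≈[_]_ public

module _ {n : ℤ} where

  ≈-refl : ∀ a → a ≈[ n ] a
  ≈-refl a = mk≈ (divides 0ℤ (trans (ℤ.+-inverseʳ a) (sym (ℤ.*-zeroˡ n))))

  ≈-reflexive : ∀ {a b} → a ≡ b → a ≈[ n ] b
  ≈-reflexive refl = ≈-refl _

  ≈-sym : ∀ {a b} → a ≈[ n ] b → b ≈[ n ] a
  ≈-sym {a} {b} (mk≈ h) = mk≈ (subst (n ∣ˢ_) (lemma a b) (Signed.∣m⇒∣-m h))
    where
    lemma : ∀ a b → - (a - b) ≡ b - a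
    lemma = solve-∀

  ≈-trans : ∀ {a b c} → a ≈[ n ] b → b ≈[ n ] c → a ≈[ n ] c
  ≈-trans {a} {b} {c} (mk≈ h₁) (mk≈ h₂) = mk≈ (subst (n ∣ˢ_) (lemma a b c) (Signed.∣m∣n⇒∣m+n h₁ h₂))
    where
    lemma : ∀ a b c → (a - b) + (b - c) ≡ a - c
    lemma = solve-∀

  +-cong : ∀ {a b c d} → a ≈[ n ] b → c ≈[ n ] d → a + c ≈[ n ] b + d
  +-cong {a} {b} {c} {d} (mk≈ h₁) (mk≈ h₂) = mk≈ (subst (n ∣ˢ_) (lemma a b c d) (Signed.∣m∣n⇒∣m+n h₁ h₂))
    where
    lemma : ∀ a b c d → (a - b) + (c - d) ≡ (a + c) - (b + d)
    lemma = solve-∀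

  sub-cong : ∀ {a b c d} → a ≈[ n ] b → c ≈[ n ] d → a - c ≈[ n ] b - d
  sub-cong {a} {b} {c} {d} (mk≈ h₁) (mk≈ h₂) = mk≈ (subst (n ∣ˢ_) (lemma a b c d) (Signed.∣m∣n⇒∣m-n h₁ h₂))
    where
    lemma : ∀ a b c d → (a - b) - (c - d) ≡ (a - c) - (b - d)
    lemma = solve-∀

  *-cong : ∀ {a b c d} → a ≈[ n ] b → c ≈[ n ] d → a * c ≈[ n ] b * d
  *-cong {a} {b} {c} {d} (mk≈ h₁) (mk≈ h₂) =
    mk≈ (subst (n ∣ˢ_) (lemma a b c d) (Signed.∣m∣n⇒∣m+n (Signed.∣m⇒∣m*n c h₁) (Signed.∣n⇒∣m*n b h₂)))
    where
    lemma : ∀ a b c d → (a - b) * c + b * (c - d) ≡ a * c - b * d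
    lemma = solve-∀

  -‿cong : ∀ {a b} → a ≈[ n ] b → - a ≈[ n ] - b
  -‿cong {a} {b} (mk≈ h) = mk≈ (subst (n ∣ˢ_) (lemma a b) (Signed.∣m⇒∣-m h))
    where
    lemma : ∀ a b → - (a - b) ≡ - a - - b
    lemma = solve-∀

  ∣-resp-≈ : ∀ {a b} → a ≈[ n ] b → n ∣ˢ b → n ∣ˢ a
  ∣-resp-≈ {a} {b} (mk≈ h₁) h₂ = subst (n ∣ˢ_) (lemma a b) (Signed.∣m∣n⇒∣m+n h₁ h₂)
    where
    lemma : ∀ a b → (a - b) + b ≡ a
    lemma = solve-∀

  ≈0⇒∣ : ∀ {a} → a ≈[ n ] 0ℤ → n ∣ˢ a
  ≈0⇒∣ {a} (mk≈ h) = subst (n ∣ˢ_) (ℤ.+-identityʳ a) h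

  ≈⇒≡+* : ∀ {a b} → a ≈[ n ] b → Σ ℤ λ q → a ≡ b + n * q
  ≈⇒≡+* {a} {b} (mk≈ (divides q eq)) = q , (begin
    a             ≡⟨ sym (lemma₁ a b) ⟩
    (a - b) + b   ≡⟨ cong (_+ b) eq ⟩
    q * n + b     ≡⟨ lemma₂ q n b ⟩
    b + n * q     ∎)
    where
    open ≡-Reasoning
    lemma₁ : ∀ a b → (a - b) + b ≡ a
    lemma₁ = solve-∀
    lemma₂ : ∀ q n b → q * n + b ≡ b + n * q
    lemma₂ = solve-∀

+-multiple-≈ : ∀ {n a m} → n ∣ˢ m → a + m ≈[ n ] a
+-multiple-≈ {n} {a} {m} n∣m = mk≈ (subst (n ∣ˢ_) (sym (lemma a m)) n∣m)
  where
  lemma : ∀ a m → a + m - a ≡ m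
  lemma = solve-∀

≈-weaken : ∀ {m n a b} → m ∣ˢ n → a ≈[ n ] b → a ≈[ m ] b
≈-weaken m∣n (mk≈ h) = mk≈ (Signed.∣-trans m∣n h)

*-scale-≈ : ∀ {n a b} k → a ≈[ n ] b → k * a ≈[ k * n ] k * b
*-scale-≈ {n} {a} {b} k (mk≈ h) = mk≈ (subst (k * n ∣ˢ_) (lemma k a b) (Signed.*-monoʳ-∣ k h))
  where
  lemma : ∀ k a b → k * (a - b) ≡ k * a - k * b
  lemma = solve-∀

toℤ : ∀ {n} → Fin n → ℤ
toℤ r = + toℕ r

-- Lemmas whose proofs run finite checks or carry divisibility witnesses are opaque:
-- otherwise Agda unfolds them during with-abstraction and unification, at prohibitive cost.
opaque
  residue : ∀ n .{{_ : ℕ.NonZero n}} (z : ℤ) → Σ (Fin n) λ r → z ≈[ + n ] toℤ r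
  residue n z = fromℕ< r<n , mk≈ (divides (z ℤ./ℕ n) (begin
    z - toℤ (fromℕ< r<n)                            ≡⟨ cong (λ w → z - + w) (Fin.toℕ-fromℕ< r<n) ⟩
    z - + (z ℤ.%ℕ n)                                ≡⟨ cong (_- + (z ℤ.%ℕ n)) (ℤ.a≡a%ℕn+[a/ℕn]*n z n) ⟩
    + (z ℤ.%ℕ n) + (z ℤ./ℕ n) * + n - + (z ℤ.%ℕ n) ≡⟨ lemma (+ (z ℤ.%ℕ n)) ((z ℤ./ℕ n) * + n) ⟩
    (z ℤ./ℕ n) * + n                                ∎))
    where
    open ≡-Reasoning
    r<n : z ℤ.%ℕ n ℕ.< n
    r<n = ℤ.n%ℕd<d z n
    lemma : ∀ a b → a + b - a ≡ b
    lemma = solve-∀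

3^_ : ℕ → ℤ
3^ k = + (3 ^ℕ k)

3^-suc : ∀ k → 3^ suc k ≡ + 3 * 3^ k
3^-suc k = ℤ.pos-* 3 (3 ^ℕ k)

3^-+ : ∀ a b → 3^ (a ℕ.+ b) ≡ 3^ a * 3^ b
3^-+ a b = trans (cong +_ (ℕ.^-distribˡ-+-* 3 a b)) (ℤ.pos-* (3 ^ℕ a) (3 ^ℕ b))

3^-mono-∣ : ∀ {a b} → a ≤ b → 3^ a ∣ˢ 3^ b
3^-mono-∣ {a} a≤b with ℕ.m≤n⇒∃[o]m+o≡n a≤b
... | d , refl = divides (3^ d) (trans (3^-+ a d) (ℤ.*-comm (3^ a) (3^ d)))

3∣3^suc : ∀ k → + 3 ∣ˢ 3^ suc k
3∣3^suc k = divides (3^ k) (trans (3^-suc k) (ℤ.*-comm (+ 3) (3^ k)))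

3^0∣ : ∀ x → 3^ 0 ∣ˢ x
3^0∣ x = divides x (sym (ℤ.*-identityʳ x))

3∣9 : + 3 ∣ˢ + 9
3∣9 = divides (+ 3) refl

9∣27 : + 9 ∣ˢ + 27
9∣27 = divides (+ 3) refl

3∣27 : + 3 ∣ˢ + 27
3∣27 = divides (+ 9) refl

Coherent : (ℕ → ℤ) → Set
Coherent f = ∀ k → f (suc k) ≈[ 3^ k ] f k

coherent-≤ : ∀ {f} → Coherent f → ∀ {k j} → k ≤ j → f j ≈[ 3^ k ] f k
coherent-≤ {f} coh {k} k≤j with ℕ.m≤n⇒∃[o]m+o≡n k≤j
... | d , refl = go d
  where
  go : ∀ d → f (k ℕ.+ d) ≈[ 3^ k ] f k
  go zero rewrite ℕ.+-identityʳ k = ≈-refl _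
  go (suc d) rewrite ℕ.+-suc k d =
    ≈-trans (≈-weaken (3^-mono-∣ (ℕ.m≤m+n k d)) (coh (k ℕ.+ d))) (go d)

seq-coherent : (x : ℤ₃) → Coherent (seq x)
seq-coherent x k = mk≈ (∣ᵤ⇒∣ (coh x k))

seq-≈ : (x : ℤ₃) → ∀ {k j} → k ≤ j → seq x j ≈[ 3^ k ] seq x k
seq-≈ x = coherent-≤ (seq-coherent x)

toℤ₃ : (f : ℕ → ℤ) → Coherent f → ℤ₃
toℤ₃ f coh = record { seq = f ; coh = λ k → ∣⇒∣ᵤ (∣-diff (coh k)) }

const₃ : ℤ → ℤ₃
const₃ z = toℤ₃ (λ _ → z) (λ _ → ≈-refl z)

neg₃ : ℤ₃ → ℤ₃
neg₃ x = toℤ₃ (λ k → - seq x k) (λ k → -‿cong (seq-coherent x k))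

IsZero₃-neg₃ : ∀ x → IsZero₃ (neg₃ x) → IsZero₃ x
IsZero₃-neg₃ x x≡0 k = ∣⇒∣ᵤ (subst (3^ k ∣ˢ_) (ℤ.neg-involutive (seq x k)) (Signed.∣m⇒∣-m (∣ᵤ⇒∣ (x≡0 k))))

const₃-nonzero : ∀ {z} → ¬ (+ 3 ∣ˢ z) → ¬ IsZero₃ (const₃ z)
const₃-nonzero 3∤z z≡0 = 3∤z (∣ᵤ⇒∣ (z≡0 1))

unit-at-level : (x : ℤ₃) → ¬ (+ 3 ∣ˢ seq x 1) → ∀ {k} → 1 ≤ k → ¬ (+ 3 ∣ˢ seq x k)
unit-at-level x 3∤x₁ 1≤k 3∣xₖ = 3∤x₁ (∣-resp-≈ (≈-sym (seq-≈ x 1≤k)) 3∣xₖ)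

coherent-shift : ∀ {f} → Coherent f → ∀ m → Coherent (λ k → f (m ℕ.+ k))
coherent-shift coh m k rewrite ℕ.+-suc m k = ≈-weaken (3^-mono-∣ (ℕ.m≤n+m k m)) (coh (m ℕ.+ k))

opaque
  coherent-∣ : ∀ {f} → Coherent f → ∀ {m j k} → m ≤ j → m ≤ k → 3^ m ∣ˢ f j → 3^ m ∣ˢ f k
  coherent-∣ coh m≤j m≤k 3^m∣fj = ∣-resp-≈ (coherent-≤ coh m≤k) (∣-resp-≈ (≈-sym (coherent-≤ coh m≤j)) 3^m∣fj)

coherent-quotient : ∀ {f q} → Coherent f → ∀ j → (∀ k → f (j ℕ.+ k) ≡ q k * 3^ j) → Coherent q
coherent-quotient {f} {q} coh j f≡q*3^j k =
  mk≈ (Signed.*-cancelʳ-∣ (3^ j) {{ℕ.m^n≢0 3 j}} (subst₂ _∣ˢ_ modulus difference (∣-diff (coh (j ℕ.+ k)))))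
  where
  open ≡-Reasoning
  modulus : 3^ (j ℕ.+ k) ≡ 3^ k * 3^ j
  modulus = trans (3^-+ j k) (ℤ.*-comm (3^ j) (3^ k))
  difference : f (suc (j ℕ.+ k)) - f (j ℕ.+ k) ≡ (q (suc k) - q k) * 3^ j
  difference = begin
    f (suc (j ℕ.+ k)) - f (j ℕ.+ k)
      ≡⟨ cong₂ _-_ (trans (cong f (sym (ℕ.+-suc j k))) (f≡q*3^j (suc k))) (f≡q*3^j k) ⟩
    q (suc k) * 3^ j - q k * 3^ j
      ≡⟨ lemma (q (suc k)) (q k) (3^ j) ⟩
    (q (suc k) - q k) * 3^ j ∎
    where
    lemma : ∀ a b p → a * p - b * p ≡ (a - b) * p
    lemma = solve-∀

-- Hensel's lemma for a cubic polynomial in one variable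

cubicPoly : (a b d e s : ℤ) → ℤ
cubicPoly a b d e s = e + d * s + b * (s * s) + a * (s * s * s)

cubicPoly′ : (a b d s : ℤ) → ℤ
cubicPoly′ a b d s = d + + 2 * b * s + + 3 * a * (s * s)

cubicPoly-cong : ∀ {n a b d e s a′ b′ d′ e′ s′} →
  a ≈[ n ] a′ → b ≈[ n ] b′ → d ≈[ n ] d′ → e ≈[ n ] e′ → s ≈[ n ] s′ →
  cubicPoly a b d e s ≈[ n ] cubicPoly a′ b′ d′ e′ s′
cubicPoly-cong a≈ b≈ d≈ e≈ s≈ =
  +-cong (+-cong (+-cong e≈ (*-cong d≈ s≈)) (*-cong b≈ (*-cong s≈ s≈))) (*-cong a≈ (*-cong (*-cong s≈ s≈) s≈))

cubicPoly-taylor : ∀ a b d e s h → cubicPoly a b d e (s + h) ≡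
  cubicPoly a b d e s + h * cubicPoly′ a b d s + h * h * (b + + 3 * a * s + a * h)
cubicPoly-taylor a b d e s h = expand a b d e s h
  where
  expand : ∀ a b d e s h →
    e + d * (s + h) + b * ((s + h) * (s + h)) + a * ((s + h) * (s + h) * (s + h)) ≡
    (e + d * s + b * (s * s) + a * (s * s * s)) + h * (d + + 2 * b * s + + 3 * a * (s * s))
      + h * h * (b + + 3 * a * s + a * h)
  expand = solve-∀

opaque
  unit-mod-3-solvable : ∀ q w → ¬ (+ 3 ∣ˢ w) → Σ (Fin 3) λ t → + 3 ∣ˢ (q + toℤ t * w)
  unit-mod-3-solvable q w 3∤w with residue 3 q | residue 3 w
  ... | Q , q≈Q | W , w≈W with solvable Q W (λ 3∣W → 3∤w (∣-resp-≈ w≈W 3∣W))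
    where
    solvable : ∀ (Q W : Fin 3) → ¬ (+ 3 ∣ˢ toℤ W) → Σ (Fin 3) λ t → + 3 ∣ˢ (toℤ Q + toℤ t * toℤ W)
    solvable = toWitness {a? = Fin.all? λ Q → Fin.all? λ W →
      ¬? (+ 3 ∣? toℤ W) →-dec Fin.any? λ t → + 3 ∣? (toℤ Q + toℤ t * toℤ W)} _
  ... | t , 3∣ = t , ∣-resp-≈ (+-cong q≈Q (*-cong (≈-refl (toℤ t)) w≈W)) 3∣

cubicPoly′-≈-linear : ∀ {n} a b d {s} → n ∣ˢ s → cubicPoly′ a b d s ≈[ n ] d
cubicPoly′-≈-linear {n} a b d {s} n∣s =
  mk≈ (subst (n ∣ˢ_) (sym (lemma a b d s)) (Signed.∣n⇒∣m*n (+ 2 * b + + 3 * a * s) n∣s))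
  where
  lemma : ∀ a b d s → d + + 2 * b * s + + 3 * a * (s * s) - d ≡ (+ 2 * b + + 3 * a * s) * s
  lemma = solve-∀

newton-step : ∀ m a b d e s → 3^ suc m ∣ˢ cubicPoly a b d e s → ¬ (+ 3 ∣ˢ cubicPoly′ a b d s) →
  Σ (Fin 3) λ t → 3^ suc (suc m) ∣ˢ cubicPoly a b d e (s + 3^ suc m * toℤ t)
newton-step m a b d e s (divides q p≡q*P) 3∤w with unit-mod-3-solvable q (cubicPoly′ a b d s) 3∤w
... | t , 3∣q+τw = t , subst (3^ suc (suc m) ∣ˢ_) (sym expansion) (Signed.∣m∣n⇒∣m+n linear quadratic)
  where
  open ≡-Reasoning
  P = 3^ suc m
  τ = toℤ t
  w = cubicPoly′ a b d s
  r = b + + 3 * a * s + a * (P * τ)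
  expansion : cubicPoly a b d e (s + P * τ) ≡ (q + τ * w) * P + P * P * (τ * τ * r)
  expansion = begin
    cubicPoly a b d e (s + P * τ)
      ≡⟨ cubicPoly-taylor a b d e s (P * τ) ⟩
    cubicPoly a b d e s + P * τ * w + P * τ * (P * τ) * r
      ≡⟨ cong (λ v → v + P * τ * w + P * τ * (P * τ) * r) p≡q*P ⟩
    q * P + P * τ * w + P * τ * (P * τ) * r
      ≡⟨ lemma q P τ w r ⟩
    (q + τ * w) * P + P * P * (τ * τ * r) ∎
    where
    lemma : ∀ q P τ w r →
      q * P + P * τ * w + P * τ * (P * τ) * r ≡ (q + τ * w) * P + P * P * (τ * τ * r)
    lemma = solve-∀
  linear : 3^ suc (suc m) ∣ˢ (q + τ * w) * P
  linear = subst (_∣ˢ (q + τ * w) * P) (sym (3^-suc (suc m))) (Signed.*-monoˡ-∣ P 3∣q+τw)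
  quadratic : 3^ suc (suc m) ∣ˢ P * P * (τ * τ * r)
  quadratic = Signed.∣m⇒∣m*n (τ * τ * r)
    (subst (3^ suc (suc m) ∣ˢ_) (3^-+ (suc m) (suc m)) (3^-mono-∣ (s≤s (ℕ.m≤n+m (suc m) m))))

opaque
  cubic-hensel : ∀ {A B D E} → Coherent A → Coherent B → Coherent D → Coherent E →
    + 3 ∣ˢ E 1 → ¬ (+ 3 ∣ˢ D 1) →
    Σ (ℕ → ℤ) λ S → Coherent S × ∀ k → 3^ k ∣ˢ cubicPoly (A k) (B k) (D k) (E k) (S k)
  cubic-hensel {A} {B} {D} {E} cohA cohB cohD cohE 3∣E₁ 3∤D₁ = root , root-coherent , root-solves
    where
    p : ℕ → ℤ → ℤ
    p k = cubicPoly (A k) (B k) (D k) (E k)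

    p-≈ : ∀ k s → p (suc k) s ≈[ 3^ k ] p k s
    p-≈ k s = cubicPoly-cong (cohA k) (cohB k) (cohD k) (cohE k) (≈-refl s)

    p′-unit : ∀ k s → + 3 ∣ˢ s → ¬ (+ 3 ∣ˢ cubicPoly′ (A (suc k)) (B (suc k)) (D (suc k)) s)
    p′-unit k s 3∣s 3∣p′ = 3∤D₁ (∣-resp-≈ (≈-sym (coherent-≤ cohD (s≤s z≤n)))
      (∣-resp-≈ (≈-sym (cubicPoly′-≈-linear (A (suc k)) (B (suc k)) (D (suc k)) 3∣s)) 3∣p′))

    -- keeping the root ≡ 0 (mod 3) keeps the derivative ≡ D ≢ 0 (mod 3)
    lift : ∀ n → Σ ℤ λ s → 3^ suc n ∣ˢ p (suc n) s × + 3 ∣ˢ s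
    lift zero = 0ℤ , subst (+ 3 ∣ˢ_) (sym (p-at-0 (A 1) (B 1) (D 1) (E 1))) 3∣E₁ , divides 0ℤ refl
      where
      p-at-0 : ∀ a b d e → e + d * 0ℤ + b * (0ℤ * 0ℤ) + a * (0ℤ * 0ℤ * 0ℤ) ≡ e
      p-at-0 = solve-∀
    lift (suc n) = step (lift n)
      where
      step : (Σ ℤ λ s → 3^ suc n ∣ˢ p (suc n) s × + 3 ∣ˢ s) →
             Σ ℤ λ s → 3^ suc (suc n) ∣ˢ p (suc (suc n)) s × + 3 ∣ˢ s
      step (s , hs , 3∣s) =
        let t , ht = newton-step n (A (suc (suc n))) (B (suc (suc n))) (D (suc (suc n))) (E (suc (suc n))) s
                       (∣-resp-≈ (p-≈ (suc n) s) hs) (p′-unit (suc n) s 3∣s)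
        in s + 3^ suc n * toℤ t , ht , Signed.∣m∣n⇒∣m+n 3∣s (Signed.∣m⇒∣m*n (toℤ t) (3∣3^suc n))

    root : ℕ → ℤ
    root n = proj₁ (lift n)

    root-coherent : Coherent root
    root-coherent k = +-multiple-≈ (Signed.∣m⇒∣m*n _ (3^-mono-∣ (ℕ.n≤1+n k)))

    root-solves : ∀ k → 3^ k ∣ˢ p k (root k)
    root-solves k = ∣-resp-≈ (≈-sym (p-≈ k (root k)))
      (Signed.∣-trans (3^-mono-∣ (ℕ.n≤1+n k)) (proj₁ (proj₂ (lift k))))

cubicℤ : (a₁ a₂ a₃ c x y z : ℤ) → ℤ
cubicℤ a₁ a₂ a₃ c x y z = a₁ * (x * x * x) + a₂ * (y * y * y) + a₃ * (z * z * z) - c * x * y * z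

cubicℤ-cong : ∀ {n a₁ a₂ a₃ c x y z b₁ b₂ b₃ d x′ y′ z′} →
  a₁ ≈[ n ] b₁ → a₂ ≈[ n ] b₂ → a₃ ≈[ n ] b₃ → c ≈[ n ] d → x ≈[ n ] x′ → y ≈[ n ] y′ → z ≈[ n ] z′ →
  cubicℤ a₁ a₂ a₃ c x y z ≈[ n ] cubicℤ b₁ b₂ b₃ d x′ y′ z′
cubicℤ-cong a₁≈ a₂≈ a₃≈ c≈ x≈ y≈ z≈ =
  sub-cong (+-cong (+-cong (*-cong a₁≈ (cube x≈)) (*-cong a₂≈ (cube y≈))) (*-cong a₃≈ (cube z≈)))
           (*-cong (*-cong (*-cong c≈ x≈) y≈) z≈)
  where
  cube : ∀ {n x x′} → x ≈[ n ] x′ → x * x * x ≈[ n ] x′ * x′ * x′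
  cube x≈ = *-cong (*-cong x≈ x≈) x≈

∂ₓcubicℤ : (a c x y z : ℤ) → ℤ
∂ₓcubicℤ a c x y z = + 3 * a * (x * x) - c * y * z

cubicℤ-taylorₓ : ∀ a₁ a₂ a₃ c x y z s →
  cubicℤ a₁ a₂ a₃ c (x + + 3 * s) y z ≡
  cubicℤ a₁ a₂ a₃ c x y z + + 3 * s * ∂ₓcubicℤ a₁ c x y z + + 27 * (a₁ * x * (s * s) + a₁ * (s * s * s))
cubicℤ-taylorₓ a₁ a₂ a₃ c x y z s = expand a₁ a₂ a₃ c x y z s
  where
  expand : ∀ a₁ a₂ a₃ c x y z s →
    a₁ * ((x + + 3 * s) * (x + + 3 * s) * (x + + 3 * s)) + a₂ * (y * y * y) + a₃ * (z * z * z)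
      - c * (x + + 3 * s) * y * z ≡
    (a₁ * (x * x * x) + a₂ * (y * y * y) + a₃ * (z * z * z) - c * x * y * z)
      + + 3 * s * (+ 3 * a₁ * (x * x) - c * y * z) + + 27 * (a₁ * x * (s * s) + a₁ * (s * s * s))
  expand = solve-∀

cubicLevel : (Fin 3 → ℤ₃) → ℤ₃ → ℕ → (x y z : ℤ) → ℤ
cubicLevel u c k = cubicℤ (seq (u 0F) k) (seq (u 1F) k) (seq (u 2F) k) (seq c k)

∂ₓcubicLevel : (Fin 3 → ℤ₃) → ℤ₃ → ℕ → (x y z : ℤ) → ℤ
∂ₓcubicLevel u c k = ∂ₓcubicℤ (seq (u 0F) k) (seq c k)

cubicLevel-coherent : ∀ u c x y z → Coherent (λ k → cubicLevel u c k x y z)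
cubicLevel-coherent u c x y z k =
  cubicℤ-cong (seq-coherent (u 0F) k) (seq-coherent (u 1F) k) (seq-coherent (u 2F) k)
              (seq-coherent c k) (≈-refl x) (≈-refl y) (≈-refl z)

∂ₓcubicLevel-coherent : ∀ u c x y z → Coherent (λ k → ∂ₓcubicLevel u c k x y z)
∂ₓcubicLevel-coherent u c x y z k =
  sub-cong (*-cong (*-cong (≈-refl (+ 3)) (seq-coherent (u 0F) k)) (≈-refl (x * x)))
           (*-cong (*-cong (seq-coherent c k) (≈-refl y)) (≈-refl z))

-- The terms of F(x₀ + 3s, y₀, z₀) of degree ≥ 2 in s carry a factor 27,
-- hence i ≤ 2 and t = 27 / 3^(i+1).
lift-along-X : ∀ u c i t → 3^ suc i * t ≡ + 27 → ∀ x₀ y₀ z₀ →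
  3^ suc (suc i) ∣ˢ cubicLevel u c (suc (suc i)) x₀ y₀ z₀ →
  3^ i ∣ˢ ∂ₓcubicLevel u c (suc (suc i)) x₀ y₀ z₀ →
  ¬ (3^ suc i ∣ˢ ∂ₓcubicLevel u c (suc (suc i)) x₀ y₀ z₀) →
  Σ ℤ₃ λ X → IsSolution u c X (const₃ y₀) (const₃ z₀)
lift-along-X u c i t 3^i⁺¹t≡27 x₀ y₀ z₀ 3^i⁺²∣F 3^i∣∂ 3^i⁺¹∤∂ = toℤ₃ X cohX , solves
  where
  open ≡-Reasoning
  F ∂ : ℕ → ℤ
  F k = cubicLevel u c k x₀ y₀ z₀
  ∂ k = ∂ₓcubicLevel u c k x₀ y₀ z₀
  cohF : Coherent F
  cohF = cubicLevel-coherent u c x₀ y₀ z₀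
  coh∂ : Coherent ∂
  coh∂ = ∂ₓcubicLevel-coherent u c x₀ y₀ z₀

  F-divisible : ∀ k → 3^ suc i ∣ˢ F (suc i ℕ.+ k)
  F-divisible k = coherent-∣ cohF (ℕ.n≤1+n (suc i)) (ℕ.m≤m+n (suc i) k)
                    (Signed.∣-trans (3^-mono-∣ (ℕ.n≤1+n (suc i))) 3^i⁺²∣F)
  ∂-divisible : ∀ k → 3^ i ∣ˢ ∂ (suc i ℕ.+ k)
  ∂-divisible k = coherent-∣ coh∂ (ℕ.m≤n+m i 2) (ℕ.≤-trans (ℕ.n≤1+n i) (ℕ.m≤m+n (suc i) k)) 3^i∣∂

  E D A B : ℕ → ℤ
  E k = Signed._∣_.quotient (F-divisible k)
  D k = Signed._∣_.quotient (∂-divisible k)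
  A k = t * seq (u 0F) (suc i ℕ.+ k)
  B k = A k * x₀

  E-eq : ∀ k → F (suc i ℕ.+ k) ≡ E k * 3^ suc i
  E-eq k = Signed._∣_.equality (F-divisible k)
  D-eq : ∀ k → ∂ (suc i ℕ.+ k) ≡ D k * 3^ i
  D-eq k = Signed._∣_.equality (∂-divisible k)

  cohA : Coherent A
  cohA k = *-cong (≈-refl t) (coherent-shift (seq-coherent (u 0F)) (suc i) k)
  cohB : Coherent B
  cohB k = *-cong (cohA k) (≈-refl x₀)
  cohD : Coherent D
  cohD = coherent-quotient (coherent-shift coh∂ 1) i D-eq
  cohE : Coherent E
  cohE = coherent-quotient cohF (suc i) E-eq

  3∣E₁ : + 3 ∣ˢ E 1
  3∣E₁ = Signed.*-cancelʳ-∣ (3^ suc i) {{ℕ.m^n≢0 3 (suc i)}}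
    (subst₂ _∣ˢ_ (3^-suc (suc i)) (E-eq 1)
      (coherent-∣ cohF ℕ.≤-refl (ℕ.≤-reflexive (sym (ℕ.+-comm (suc i) 1))) 3^i⁺²∣F))
  3∤D₁ : ¬ (+ 3 ∣ˢ D 1)
  3∤D₁ 3∣D₁ = 3^i⁺¹∤∂ (coherent-∣ coh∂ (ℕ.m≤m+n (suc i) 1) (ℕ.n≤1+n (suc i))
    (subst₂ _∣ˢ_ (sym (3^-suc i)) (sym (D-eq 1)) (Signed.*-monoˡ-∣ (3^ i) 3∣D₁)))

  hensel : Σ (ℕ → ℤ) λ S → Coherent S × ∀ k → 3^ k ∣ˢ cubicPoly (A k) (B k) (D k) (E k) (S k)
  hensel = cubic-hensel cohA cohB cohD cohE 3∣E₁ 3∤D₁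
  S : ℕ → ℤ
  S = proj₁ hensel

  X : ℕ → ℤ
  X k = x₀ + + 3 * S k
  cohX : Coherent X
  cohX k = +-cong (≈-refl x₀) (*-cong (≈-refl (+ 3)) (proj₁ (proj₂ hensel) k))

  scaled : ∀ k s → 3^ suc i * cubicPoly (A k) (B k) (D k) (E k) s ≡
                   cubicLevel u c (suc i ℕ.+ k) (x₀ + + 3 * s) y₀ z₀
  scaled k s = begin
    3^ suc i * cubicPoly (A k) (B k) (D k) (E k) s
      ≡⟨ cong (_* cubicPoly (A k) (B k) (D k) (E k) s) (3^-suc i) ⟩
    + 3 * p * cubicPoly (A k) (B k) (D k) (E k) s
      ≡⟨ rearrange (E k) (D k) a x₀ s p t ⟩
    E k * (+ 3 * p) + + 3 * s * (D k * p) + + 3 * p * t * higher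
      ≡⟨ cong₂ (λ e v → e + + 3 * s * (D k * p) + v * higher)
               (trans (cong (E k *_) (sym (3^-suc i))) (sym (E-eq k)))
               (trans (cong (_* t) (sym (3^-suc i))) 3^i⁺¹t≡27) ⟩
    F j + + 3 * s * (D k * p) + + 27 * higher
      ≡⟨ cong (λ d → F j + + 3 * s * d + + 27 * higher) (sym (D-eq k)) ⟩
    F j + + 3 * s * ∂ j + + 27 * higher
      ≡⟨ sym (cubicℤ-taylorₓ a (seq (u 1F) j) (seq (u 2F) j) (seq c j) x₀ y₀ z₀ s) ⟩
    cubicLevel u c j (x₀ + + 3 * s) y₀ z₀ ∎
    where
    j = suc i ℕ.+ k
    p = 3^ i
    a = seq (u 0F) j
    higher = a * x₀ * (s * s) + a * (s * s * s)
    rearrange : ∀ e d a x s p t →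
      + 3 * p * (e + d * s + t * a * x * (s * s) + t * a * (s * s * s)) ≡
      e * (+ 3 * p) + + 3 * s * (d * p) + + 3 * p * t * (a * x * (s * s) + a * (s * s * s))
    rearrange = solve-∀

  solves : IsSolution u c (toℤ₃ X cohX) (const₃ y₀) (const₃ z₀)
  solves k = ∣⇒∣ᵤ (∣-resp-≈ (≈-sym (coherent-≤ (cubicLevel-coherent u c (X k) y₀ z₀) (ℕ.m≤n+m k (suc i))))
    (Signed.∣-trans (3^-mono-∣ (ℕ.m≤n+m k (suc i)))
      (subst₂ _∣ˢ_ (sym (3^-+ (suc i) k)) (scaled k (S k))
        (Signed.*-monoʳ-∣ (3^ suc i) (proj₂ (proj₂ hensel) k)))))

solution-transfer : ∀ u c v d (X Y Z X′ Y′ Z′ : ℤ₃) →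
  (∀ k → cubicAt v d X Y Z k ≡ cubicAt u c X′ Y′ Z′ k) →
  (IsZero₃ X′ × IsZero₃ Y′ × IsZero₃ Z′ → IsZero₃ X × IsZero₃ Y × IsZero₃ Z) →
  IsSolution v d X Y Z → ¬ (IsZero₃ X × IsZero₃ Y × IsZero₃ Z) → HasNontrivialSolution u c
solution-transfer u c v d X Y Z X′ Y′ Z′ same-value zeros-back solves nontrivial =
  X′ , Y′ , Z′ , (λ k → subst (+ _ ∣_) (same-value k) (solves k)) , nontrivial ∘ zeros-back

σ₀₁ σ₀₂ σ₁₂ : Fin 3 → Fin 3
σ₀₁ 0F = 1F
σ₀₁ 1F = 0F
σ₀₁ 2F = 2F
σ₀₂ 0F = 2F
σ₀₂ 1F = 1F
σ₀₂ 2F = 0F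
σ₁₂ 0F = 0F
σ₁₂ 1F = 2F
σ₁₂ 2F = 1F

σ₀₁-solution : ∀ u c → HasNontrivialSolution (u ∘ σ₀₁) c → HasNontrivialSolution u c
σ₀₁-solution u c (X , Y , Z , solves , nontrivial) =
  solution-transfer u c (u ∘ σ₀₁) c X Y Z Y X Z
    (λ k → swap (seq (u 0F) k) (seq (u 1F) k) (seq (u 2F) k) (seq c k) (seq X k) (seq Y k) (seq Z k))
    (λ (y≡0 , x≡0 , z≡0) → x≡0 , y≡0 , z≡0) solves nontrivial
  where
  swap : ∀ a₁ a₂ a₃ c x y z → a₂ * (x * x * x) + a₁ * (y * y * y) + a₃ * (z * z * z) - c * x * y * z ≡
                               a₁ * (y * y * y) + a₂ * (x * x * x) + a₃ * (z * z * z) - c * y * x * z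
  swap = solve-∀

σ₀₂-solution : ∀ u c → HasNontrivialSolution (u ∘ σ₀₂) c → HasNontrivialSolution u c
σ₀₂-solution u c (X , Y , Z , solves , nontrivial) =
  solution-transfer u c (u ∘ σ₀₂) c X Y Z Z Y X
    (λ k → swap (seq (u 0F) k) (seq (u 1F) k) (seq (u 2F) k) (seq c k) (seq X k) (seq Y k) (seq Z k))
    (λ (z≡0 , y≡0 , x≡0) → x≡0 , y≡0 , z≡0) solves nontrivial
  where
  swap : ∀ a₁ a₂ a₃ c x y z → a₃ * (x * x * x) + a₂ * (y * y * y) + a₁ * (z * z * z) - c * x * y * z ≡
                               a₁ * (z * z * z) + a₂ * (y * y * y) + a₃ * (x * x * x) - c * z * y * x
  swap = solve-∀

σ₁₂-solution : ∀ u c → HasNontrivialSolution (u ∘ σ₁₂) c → HasNontrivialSolution u c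
σ₁₂-solution u c (X , Y , Z , solves , nontrivial) =
  solution-transfer u c (u ∘ σ₁₂) c X Y Z X Z Y
    (λ k → swap (seq (u 0F) k) (seq (u 1F) k) (seq (u 2F) k) (seq c k) (seq X k) (seq Y k) (seq Z k))
    (λ (x≡0 , z≡0 , y≡0) → x≡0 , y≡0 , z≡0) solves nontrivial
  where
  swap : ∀ a₁ a₂ a₃ c x y z → a₁ * (x * x * x) + a₃ * (y * y * y) + a₂ * (z * z * z) - c * x * y * z ≡
                               a₁ * (x * x * x) + a₂ * (z * z * z) + a₃ * (y * y * y) - c * x * z * y
  swap = solve-∀

neg₁₂ neg₁ neg₂ : (Fin 3 → ℤ₃) → Fin 3 → ℤ₃
neg₁₂ u 0F = u 0F
neg₁₂ u 1F = neg₃ (u 1F)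
neg₁₂ u 2F = neg₃ (u 2F)
neg₁ u 0F = u 0F
neg₁ u 1F = neg₃ (u 1F)
neg₁ u 2F = u 2F
neg₂ u 0F = u 0F
neg₂ u 1F = u 1F
neg₂ u 2F = neg₃ (u 2F)

neg₁₂-solution : ∀ u c → HasNontrivialSolution (neg₁₂ u) c → HasNontrivialSolution u c
neg₁₂-solution u c (X , Y , Z , solves , nontrivial) =
  solution-transfer u c (neg₁₂ u) c X Y Z X (neg₃ Y) (neg₃ Z)
    (λ k → flip (seq (u 0F) k) (seq (u 1F) k) (seq (u 2F) k) (seq c k) (seq X k) (seq Y k) (seq Z k))
    (λ (x≡0 , y≡0 , z≡0) → x≡0 , IsZero₃-neg₃ Y y≡0 , IsZero₃-neg₃ Z z≡0) solves nontrivial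
  where
  flip : ∀ a₁ a₂ a₃ c x y z → a₁ * (x * x * x) + - a₂ * (y * y * y) + - a₃ * (z * z * z) - c * x * y * z ≡
                               a₁ * (x * x * x) + a₂ * (- y * - y * - y) + a₃ * (- z * - z * - z)
                                 - c * x * - y * - z
  flip = solve-∀

neg₁-solution : ∀ u c → HasNontrivialSolution (neg₁ u) (neg₃ c) → HasNontrivialSolution u c
neg₁-solution u c (X , Y , Z , solves , nontrivial) =
  solution-transfer u c (neg₁ u) (neg₃ c) X Y Z X (neg₃ Y) Z
    (λ k → flip (seq (u 0F) k) (seq (u 1F) k) (seq (u 2F) k) (seq c k) (seq X k) (seq Y k) (seq Z k))
    (λ (x≡0 , y≡0 , z≡0) → x≡0 , IsZero₃-neg₃ Y y≡0 , z≡0) solves nontrivial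
  where
  flip : ∀ a₁ a₂ a₃ c x y z → a₁ * (x * x * x) + - a₂ * (y * y * y) + a₃ * (z * z * z) - - c * x * y * z ≡
                               a₁ * (x * x * x) + a₂ * (- y * - y * - y) + a₃ * (z * z * z) - c * x * - y * z
  flip = solve-∀

neg₂-solution : ∀ u c → HasNontrivialSolution (neg₂ u) (neg₃ c) → HasNontrivialSolution u c
neg₂-solution u c (X , Y , Z , solves , nontrivial) =
  solution-transfer u c (neg₂ u) (neg₃ c) X Y Z X Y (neg₃ Z)
    (λ k → flip (seq (u 0F) k) (seq (u 1F) k) (seq (u 2F) k) (seq c k) (seq X k) (seq Y k) (seq Z k))
    (λ (x≡0 , y≡0 , z≡0) → x≡0 , y≡0 , IsZero₃-neg₃ Z z≡0) solves nontrivial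
  where
  flip : ∀ a₁ a₂ a₃ c x y z → a₁ * (x * x * x) + a₂ * (y * y * y) + - a₃ * (z * z * z) - - c * x * y * z ≡
                               a₁ * (x * x * x) + a₂ * (y * y * y) + a₃ * (- z * - z * - z) - c * x * y * - z
  flip = solve-∀

-- Solutions when some uᵢ ≡ ±uⱼ (mod 9)

solution-with-Z=0 : ∀ u c y₀ → ¬ (+ 3 ∣ˢ seq (u 0F) 1) → ¬ (+ 3 ∣ˢ y₀) →
  + 9 ∣ˢ (seq (u 0F) 2 + seq (u 1F) 2 * (y₀ * y₀ * y₀)) → HasNontrivialSolution u c
solution-with-Z=0 u c y₀ 3∤u₀ 3∤y₀ 9∣value₂
  with ∣-resp-≈ (+-cong (seq-≈ (u 0F) 2≤3) (*-cong (seq-≈ (u 1F) 2≤3) (≈-refl (y₀ * y₀ * y₀)))) 9∣value₂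
  where
  2≤3 : 2 ≤ 3
  2≤3 = s≤s (s≤s z≤n)
... | divides q value≡q*9 with unit-mod-3-solvable q (seq (u 0F) 3) (unit-at-level (u 0F) 3∤u₀ (s≤s z≤n))
... | s₀ , 3∣q+sa =
  proj₁ lifted , const₃ y₀ , const₃ 0ℤ , proj₂ lifted , λ (_ , y≡0 , _) → const₃-nonzero 3∤y₀ y≡0
  where
  open ≡-Reasoning
  a = seq (u 0F) 3
  s = toℤ s₀
  x₀ = + 1 + + 3 * s
  higher = a * s * s + a * s * s * s

  F-value : cubicLevel u c 3 x₀ y₀ 0ℤ ≡ (q + s * a) * + 9 + + 27 * higher
  F-value = begin
    cubicLevel u c 3 x₀ y₀ 0ℤ
      ≡⟨ expand a (seq (u 1F) 3) (seq (u 2F) 3) (seq c 3) y₀ s ⟩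
    (a + seq (u 1F) 3 * (y₀ * y₀ * y₀)) + + 9 * a * s + + 27 * higher
      ≡⟨ cong (λ v → v + + 9 * a * s + + 27 * higher) value≡q*9 ⟩
    q * + 9 + + 9 * a * s + + 27 * higher
      ≡⟨ collect q a s higher ⟩
    (q + s * a) * + 9 + + 27 * higher ∎
    where
    expand : ∀ a b d c y s →
      a * ((+ 1 + + 3 * s) * (+ 1 + + 3 * s) * (+ 1 + + 3 * s)) + b * (y * y * y) + d * (0ℤ * 0ℤ * 0ℤ)
        - c * (+ 1 + + 3 * s) * y * 0ℤ
      ≡ (a + b * (y * y * y)) + + 9 * a * s + + 27 * (a * s * s + a * s * s * s)
    expand = solve-∀
    collect : ∀ q a s r → q * + 9 + + 9 * a * s + + 27 * r ≡ (q + s * a) * + 9 + + 27 * r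
    collect = solve-∀

  ∂-value : ∂ₓcubicLevel u c 3 x₀ y₀ 0ℤ ≡ a * (x₀ * x₀) * + 3
  ∂-value = expand a (seq c 3) y₀ x₀
    where
    expand : ∀ a c y x → + 3 * a * (x * x) - c * y * 0ℤ ≡ a * (x * x) * + 3
    expand = solve-∀

  3∤ax₀² : ¬ (+ 3 ∣ˢ a * (x₀ * x₀))
  3∤ax₀² = unit-at-level (u 0F) 3∤u₀ (s≤s z≤n) ∘ ∣-resp-≈ (≈-sym ax₀²≈a)
    where
    x₀≈1 : x₀ ≈[ + 3 ] + 1
    x₀≈1 = +-multiple-≈ (Signed.∣m⇒∣m*n s Signed.∣-refl)
    ax₀²≈a : a * (x₀ * x₀) ≈[ + 3 ] a
    ax₀²≈a = ≈-trans (*-cong (≈-refl a) (*-cong x₀≈1 x₀≈1)) (≈-reflexive (ℤ.*-identityʳ a))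

  lifted : Σ ℤ₃ λ X → IsSolution u c X (const₃ y₀) (const₃ 0ℤ)
  lifted = lift-along-X u c 1 (+ 3) refl x₀ y₀ 0ℤ
    (subst (3^ 3 ∣ˢ_) (sym F-value)
      (Signed.∣m∣n⇒∣m+n (Signed.*-monoˡ-∣ (+ 9) 3∣q+sa) (Signed.∣m⇒∣m*n higher Signed.∣-refl)))
    (subst (3^ 1 ∣ˢ_) (sym ∂-value) (Signed.∣n⇒∣m*n (a * (x₀ * x₀)) Signed.∣-refl))
    (λ 9∣∂ → 3∤ax₀² (Signed.*-cancelʳ-∣ (+ 3) (subst (3^ 2 ∣ˢ_) ∂-value 9∣∂)))

PlusMinusMod9-sym : ∀ u i j → PlusMinusMod9 u i j → PlusMinusMod9 u j i
PlusMinusMod9-sym u i j (inj₁ 9∣uᵢ-uⱼ) =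
  inj₁ (∣⇒∣ᵤ (∣-diff (≈-sym {+ 9} {seq (u i) 2} (mk≈ (∣ᵤ⇒∣ 9∣uᵢ-uⱼ)))))
PlusMinusMod9-sym u i j (inj₂ 9∣uᵢ+uⱼ) = inj₂ (subst (+ 9 ∣_) (ℤ.+-comm (seq (u i) 2) (seq (u j) 2)) 9∣uᵢ+uⱼ)

solution-from-PlusMinusMod9₀₁ : ∀ u c → (∀ i → ¬ (+ 3 ∣ˢ seq (u i) 1)) → PlusMinusMod9 u 0F 1F →
  HasNontrivialSolution u c
solution-from-PlusMinusMod9₀₁ u c units (inj₁ 9∣u₀-u₁) =
  solution-with-Z=0 u c -1ℤ (units 0F) (toWitnessFalse {a? = + 3 ∣? -1ℤ} _)
    (subst (+ 9 ∣ˢ_) (sym (cubed (seq (u 0F) 2) (seq (u 1F) 2))) (∣ᵤ⇒∣ 9∣u₀-u₁))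
  where
  cubed : ∀ a b → a + b * (-1ℤ * -1ℤ * -1ℤ) ≡ a - b
  cubed = solve-∀
solution-from-PlusMinusMod9₀₁ u c units (inj₂ 9∣u₀+u₁) =
  solution-with-Z=0 u c 1ℤ (units 0F) (toWitnessFalse {a? = + 3 ∣? 1ℤ} _)
    (subst (+ 9 ∣ˢ_) (sym (cubed (seq (u 0F) 2) (seq (u 1F) 2))) (∣ᵤ⇒∣ 9∣u₀+u₁))
  where
  cubed : ∀ a b → a + b * (1ℤ * 1ℤ * 1ℤ) ≡ a + b
  cubed = solve-∀

solution-from-PlusMinusMod9 : ∀ u c → (∀ i → ¬ (+ 3 ∣ˢ seq (u i) 1)) →
  (Σ (Fin 3) λ i → Σ (Fin 3) λ j → i ≢ j × PlusMinusMod9 u i j) → HasNontrivialSolution u c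
solution-from-PlusMinusMod9 u c units (0F , 0F , 0≢0 , _) = ⊥-elim (0≢0 refl)
solution-from-PlusMinusMod9 u c units (1F , 1F , 1≢1 , _) = ⊥-elim (1≢1 refl)
solution-from-PlusMinusMod9 u c units (2F , 2F , 2≢2 , _) = ⊥-elim (2≢2 refl)
solution-from-PlusMinusMod9 u c units (0F , 1F , _ , pm) =
  solution-from-PlusMinusMod9₀₁ u c units pm
solution-from-PlusMinusMod9 u c units (1F , 0F , _ , pm) =
  solution-from-PlusMinusMod9₀₁ u c units (PlusMinusMod9-sym u 1F 0F pm)
solution-from-PlusMinusMod9 u c units (0F , 2F , _ , pm) =
  σ₁₂-solution u c (solution-from-PlusMinusMod9₀₁ (u ∘ σ₁₂) c (units ∘ σ₁₂) pm)
solution-from-PlusMinusMod9 u c units (2F , 0F , _ , pm) =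
  σ₁₂-solution u c (solution-from-PlusMinusMod9₀₁ (u ∘ σ₁₂) c (units ∘ σ₁₂) (PlusMinusMod9-sym u 2F 0F pm))
solution-from-PlusMinusMod9 u c units (2F , 1F , _ , pm) =
  σ₀₂-solution u c (solution-from-PlusMinusMod9₀₁ (u ∘ σ₀₂) c (units ∘ σ₀₂) pm)
solution-from-PlusMinusMod9 u c units (1F , 2F , _ , pm) =
  σ₀₂-solution u c (solution-from-PlusMinusMod9₀₁ (u ∘ σ₀₂) c (units ∘ σ₀₂) (PlusMinusMod9-sym u 1F 2F pm))

PlusMinus9 : ℤ → ℤ → Set
PlusMinus9 a b = + 9 ∣ˢ (a - b) ⊎ + 9 ∣ˢ (a + b)

PlusMinus9-resp-≈ : ∀ {a a′ b b′} → a ≈[ + 9 ] a′ → b ≈[ + 9 ] b′ → PlusMinus9 a′ b′ → PlusMinus9 a b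
PlusMinus9-resp-≈ a≈ b≈ (inj₁ 9∣a′-b′) = inj₁ (∣-resp-≈ (sub-cong a≈ b≈) 9∣a′-b′)
PlusMinus9-resp-≈ a≈ b≈ (inj₂ 9∣a′+b′) = inj₂ (∣-resp-≈ (+-cong a≈ b≈) 9∣a′+b′)

Admissible : (u₁ u₂ u₃ : ℤ) → Set
Admissible u₁ u₂ u₃ = ¬ (+ 3 ∣ˢ u₁) × ¬ (+ 3 ∣ˢ u₂) × ¬ (+ 3 ∣ˢ u₃) ×
  ¬ PlusMinus9 u₁ u₂ × ¬ PlusMinus9 u₁ u₃ × ¬ PlusMinus9 u₂ u₃

admissible? : ∀ u₁ u₂ u₃ → Dec (Admissible u₁ u₂ u₃)
admissible? u₁ u₂ u₃ = ¬? (+ 3 ∣? u₁) ×-dec ¬? (+ 3 ∣? u₂) ×-dec ¬? (+ 3 ∣? u₃) ×-dec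
  ¬? (PlusMinus9? u₁ u₂) ×-dec ¬? (PlusMinus9? u₁ u₃) ×-dec ¬? (PlusMinus9? u₂ u₃)
  where
  PlusMinus9? : ∀ a b → Dec (PlusMinus9 a b)
  PlusMinus9? a b = (+ 9 ∣? (a - b)) ⊎-dec (+ 9 ∣? (a + b))

Admissible-resp-≈ : ∀ {u₁ u₂ u₃ v₁ v₂ v₃} → u₁ ≈[ + 9 ] v₁ → u₂ ≈[ + 9 ] v₂ → u₃ ≈[ + 9 ] v₃ →
  Admissible u₁ u₂ u₃ → Admissible v₁ v₂ v₃
Admissible-resp-≈ u₁≈ u₂≈ u₃≈ (3∤u₁ , 3∤u₂ , 3∤u₃ , ¬pm₁₂ , ¬pm₁₃ , ¬pm₂₃) =
  unit u₁≈ 3∤u₁ , unit u₂≈ 3∤u₂ , unit u₃≈ 3∤u₃ ,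
  ¬pm₁₂ ∘ PlusMinus9-resp-≈ u₁≈ u₂≈ , ¬pm₁₃ ∘ PlusMinus9-resp-≈ u₁≈ u₃≈ , ¬pm₂₃ ∘ PlusMinus9-resp-≈ u₂≈ u₃≈
  where
  unit : ∀ {u v} → u ≈[ + 9 ] v → ¬ (+ 3 ∣ˢ u) → ¬ (+ 3 ∣ˢ v)
  unit u≈v 3∤u = 3∤u ∘ ∣-resp-≈ (≈-weaken 3∣9 u≈v)

-- Necessity of the sign condition

cube-≈-mod-9 : ∀ {x r} → x ≈[ + 3 ] r → x * x * x ≈[ + 9 ] r * r * r
cube-≈-mod-9 {x} {r} x≈r with ≈⇒≡+* x≈r
... | q , refl = mk≈ (divides (q * (r * r) + + 3 * q * q * r + + 3 * q * q * q) (expand r q))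
  where
  expand : ∀ r q → (r + + 3 * q) * (r + + 3 * q) * (r + + 3 * q) - r * r * r ≡
                   (q * (r * r) + + 3 * q * q * r + + 3 * q * q * q) * + 9
  expand = solve-∀

cubicℤ-≈-mod-9 : ∀ {u₁ u₂ u₃ C x y z v₁ v₂ v₃ D x′ y′ z′} →
  u₁ ≈[ + 9 ] v₁ → u₂ ≈[ + 9 ] v₂ → u₃ ≈[ + 9 ] v₃ → C ≈[ + 3 ] D →
  x ≈[ + 3 ] x′ → y ≈[ + 3 ] y′ → z ≈[ + 3 ] z′ →
  cubicℤ u₁ u₂ u₃ (C * + 3) x y z ≈[ + 9 ] cubicℤ v₁ v₂ v₃ (D * + 3) x′ y′ z′
cubicℤ-≈-mod-9 {C = C} {x} {y} {z} {D = D} {x′} {y′} {z′} u₁≈ u₂≈ u₃≈ C≈ x≈ y≈ z≈ =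
  sub-cong (+-cong (+-cong (*-cong u₁≈ (cube-≈-mod-9 x≈)) (*-cong u₂≈ (cube-≈-mod-9 y≈)))
                   (*-cong u₃≈ (cube-≈-mod-9 z≈)))
    (≈-trans (≈-reflexive (factor C x y z))
      (≈-trans (*-scale-≈ (+ 3) (*-cong (*-cong (*-cong C≈ x≈) y≈) z≈))
               (≈-reflexive (sym (factor D x′ y′ z′)))))
  where
  factor : ∀ C x y z → C * + 3 * x * y * z ≡ + 3 * (C * x * y * z)
  factor = solve-∀

AllDivisibleBy3 : (x y z : ℤ) → Set
AllDivisibleBy3 x y z = + 3 ∣ˢ x × + 3 ∣ˢ y × + 3 ∣ˢ z

Balanced : (u₁ u₂ u₃ C x y z : ℤ) → Set
Balanced u₁ u₂ u₃ C x y z = + 3 ∣ˢ (u₁ - C * y * z) × + 3 ∣ˢ (u₂ - C * x * z) × + 3 ∣ˢ (u₃ - C * x * y)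

DivisibleOrBalanced : (u₁ u₂ u₃ C x y z : ℤ) → Set
DivisibleOrBalanced u₁ u₂ u₃ C x y z = AllDivisibleBy3 x y z ⊎ Balanced u₁ u₂ u₃ C x y z

opaque
  zero-mod-9-table : ∀ (U₁ U₂ U₃ : Fin 9) → Admissible (toℤ U₁) (toℤ U₂) (toℤ U₃) → ∀ (C r₁ r₂ r₃ : Fin 3) →
    + 9 ∣ˢ cubicℤ (toℤ U₁) (toℤ U₂) (toℤ U₃) (toℤ C * + 3) (toℤ r₁) (toℤ r₂) (toℤ r₃) →
    DivisibleOrBalanced (toℤ U₁) (toℤ U₂) (toℤ U₃) (toℤ C) (toℤ r₁) (toℤ r₂) (toℤ r₃)
  zero-mod-9-table = toWitness {a? =
    Fin.all? λ U₁ → Fin.all? λ U₂ → Fin.all? λ U₃ → admissible? (toℤ U₁) (toℤ U₂) (toℤ U₃) →-dec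
    Fin.all? λ C → Fin.all? λ r₁ → Fin.all? λ r₂ → Fin.all? λ r₃ →
      (+ 9 ∣? cubicℤ (toℤ U₁) (toℤ U₂) (toℤ U₃) (toℤ C * + 3) (toℤ r₁) (toℤ r₂) (toℤ r₃)) →-dec
      ((+ 3 ∣? toℤ r₁ ×-dec + 3 ∣? toℤ r₂ ×-dec + 3 ∣? toℤ r₃) ⊎-dec
       (+ 3 ∣? (toℤ U₁ - toℤ C * toℤ r₂ * toℤ r₃) ×-dec + 3 ∣? (toℤ U₂ - toℤ C * toℤ r₁ * toℤ r₃) ×-dec
        + 3 ∣? (toℤ U₃ - toℤ C * toℤ r₁ * toℤ r₂)))} _

opaque
  zero-mod-9-classification : ∀ {u₁ u₂ u₃} C x y z → Admissible u₁ u₂ u₃ →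
    + 9 ∣ˢ cubicℤ u₁ u₂ u₃ (C * + 3) x y z → DivisibleOrBalanced u₁ u₂ u₃ C x y z
  zero-mod-9-classification {u₁} {u₂} {u₃} C x y z adm 9∣F
    with residue 9 u₁ | residue 9 u₂ | residue 9 u₃ | residue 3 C | residue 3 x | residue 3 y | residue 3 z
  ... | U₁ , u₁≈ | U₂ , u₂≈ | U₃ , u₃≈ | C′ , C≈ | r₁ , x≈ | r₂ , y≈ | r₃ , z≈ =
    lift-back (zero-mod-9-table U₁ U₂ U₃ (Admissible-resp-≈ u₁≈ u₂≈ u₃≈ adm) C′ r₁ r₂ r₃
                                (∣-resp-≈ (≈-sym F≈) 9∣F))
    where
    F≈ : cubicℤ u₁ u₂ u₃ (C * + 3) x y z ≈[ + 9 ]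
         cubicℤ (toℤ U₁) (toℤ U₂) (toℤ U₃) (toℤ C′ * + 3) (toℤ r₁) (toℤ r₂) (toℤ r₃)
    F≈ = cubicℤ-≈-mod-9 u₁≈ u₂≈ u₃≈ C≈ x≈ y≈ z≈

    relation : ∀ {u U v V w W} → u ≈[ + 9 ] U → v ≈[ + 3 ] V → w ≈[ + 3 ] W →
               u - C * v * w ≈[ + 3 ] U - toℤ C′ * V * W
    relation u≈ v≈ w≈ = sub-cong (≈-weaken 3∣9 u≈) (*-cong (*-cong C≈ v≈) w≈)

    lift-back : DivisibleOrBalanced (toℤ U₁) (toℤ U₂) (toℤ U₃) (toℤ C′) (toℤ r₁) (toℤ r₂) (toℤ r₃) →
                DivisibleOrBalanced u₁ u₂ u₃ C x y z
    lift-back (inj₁ (3∣r₁ , 3∣r₂ , 3∣r₃)) = inj₁ (∣-resp-≈ x≈ 3∣r₁ , ∣-resp-≈ y≈ 3∣r₂ , ∣-resp-≈ z≈ 3∣r₃)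
    lift-back (inj₂ (b₁ , b₂ , b₃)) =
      inj₂ (∣-resp-≈ (relation u₁≈ y≈ z≈) b₁ , ∣-resp-≈ (relation u₂≈ x≈ z≈) b₂ ,
            ∣-resp-≈ (relation u₃≈ x≈ y≈) b₃)

IsSign-* : ∀ {a b} → IsSign a → IsSign b → IsSign (a * b)
IsSign-* (inj₁ refl) (inj₁ refl) = inj₁ refl
IsSign-* (inj₁ refl) (inj₂ refl) = inj₂ refl
IsSign-* (inj₂ refl) (inj₁ refl) = inj₂ refl
IsSign-* (inj₂ refl) (inj₂ refl) = inj₁ refl

unit-≈-sign : ∀ {x} → ¬ (+ 3 ∣ˢ x) → Σ ℤ λ e → IsSign e × x ≈[ + 3 ] e
unit-≈-sign {x} 3∤x with residue 3 x
... | 0F , x≈0 = ⊥-elim (3∤x (≈0⇒∣ x≈0))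
... | 1F , x≈1 = 1ℤ , inj₁ refl , x≈1
... | 2F , x≈2 = -1ℤ , inj₂ refl , ≈-trans x≈2 (mk≈ (divides 1ℤ refl))

SignConditionℤ : (u₁ u₂ u₃ c : ℤ) → Set
SignConditionℤ u₁ u₂ u₃ c =
  Σ ℤ λ s₁ → Σ ℤ λ s₂ → IsSign s₁ × IsSign s₂ × + 27 ∣ˢ (c - (s₁ * u₁ + s₂ * u₂ + s₁ * s₂ * u₃))

-- Expanding F(e₁ + 3a₁, e₂ + 3a₂, e₃ + 3a₃) with eᵢ² = 1: modulo 27 only the terms eᵢuᵢ - 3Ce₁e₂e₃
-- and 9aᵢ(uᵢ - Ceⱼeₖ) survive.
sign-identity : ∀ {e₁ e₂ e₃} → IsSign e₁ → IsSign e₂ → IsSign e₃ → ∀ u₁ u₂ u₃ C a₁ a₂ a₃ →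
  C * + 3 - (e₂ * e₃ * u₁ + e₁ * e₃ * u₂ + e₂ * e₃ * (e₁ * e₃) * u₃) ≡
  - (e₁ * e₂ * e₃) * (
      (u₁ * ((e₁ + + 3 * a₁) * (e₁ + + 3 * a₁) * (e₁ + + 3 * a₁))
        + u₂ * ((e₂ + + 3 * a₂) * (e₂ + + 3 * a₂) * (e₂ + + 3 * a₂))
        + u₃ * ((e₃ + + 3 * a₃) * (e₃ + + 3 * a₃) * (e₃ + + 3 * a₃))
        - C * + 3 * (e₁ + + 3 * a₁) * (e₂ + + 3 * a₂) * (e₃ + + 3 * a₃))
    - + 9 * (a₁ * (u₁ - C * e₂ * e₃) + a₂ * (u₂ - C * e₁ * e₃) + a₃ * (u₃ - C * e₁ * e₂))
    - + 27 * (u₁ * (e₁ * a₁ * a₁ + a₁ * a₁ * a₁) + u₂ * (e₂ * a₂ * a₂ + a₂ * a₂ * a₂)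
              + u₃ * (e₃ * a₃ * a₃ + a₃ * a₃ * a₃)
              - C * (a₁ * a₂ * e₃ + a₁ * e₂ * a₃ + e₁ * a₂ * a₃) - + 3 * C * a₁ * a₂ * a₃))
sign-identity (inj₁ refl) (inj₁ refl) (inj₁ refl) = solve-∀
sign-identity (inj₁ refl) (inj₁ refl) (inj₂ refl) = solve-∀
sign-identity (inj₁ refl) (inj₂ refl) (inj₁ refl) = solve-∀
sign-identity (inj₁ refl) (inj₂ refl) (inj₂ refl) = solve-∀
sign-identity (inj₂ refl) (inj₁ refl) (inj₁ refl) = solve-∀
sign-identity (inj₂ refl) (inj₁ refl) (inj₂ refl) = solve-∀
sign-identity (inj₂ refl) (inj₂ refl) (inj₁ refl) = solve-∀
sign-identity (inj₂ refl) (inj₂ refl) (inj₂ refl) = solve-∀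

sign-condition-from-balanced : ∀ {e₁ e₂ e₃} → IsSign e₁ → IsSign e₂ → IsSign e₃ → ∀ {u₁ u₂ u₃} C {x y z} →
  x ≈[ + 3 ] e₁ → y ≈[ + 3 ] e₂ → z ≈[ + 3 ] e₃ →
  + 27 ∣ˢ cubicℤ u₁ u₂ u₃ (C * + 3) x y z → Balanced u₁ u₂ u₃ C e₁ e₂ e₃ → SignConditionℤ u₁ u₂ u₃ (C * + 3)
sign-condition-from-balanced sign₁ sign₂ sign₃ C x≈e₁ y≈e₂ z≈e₃ 27∣F balanced
  with ≈⇒≡+* x≈e₁ | ≈⇒≡+* y≈e₂ | ≈⇒≡+* z≈e₃
sign-condition-from-balanced {e₁} {e₂} {e₃} sign₁ sign₂ sign₃ {u₁} {u₂} {u₃} C _ _ _ 27∣F (b₁ , b₂ , b₃)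
  | a₁ , refl | a₂ , refl | a₃ , refl =
  e₂ * e₃ , e₁ * e₃ , IsSign-* sign₂ sign₃ , IsSign-* sign₁ sign₃ ,
  subst (+ 27 ∣ˢ_) (sym (sign-identity sign₁ sign₂ sign₃ u₁ u₂ u₃ C a₁ a₂ a₃))
    (Signed.∣n⇒∣m*n (- (e₁ * e₂ * e₃)) (Signed.∣m∣n⇒∣m-n (Signed.∣m∣n⇒∣m-n 27∣F (Signed.*-monoʳ-∣ (+ 9) 3∣Σ))
                                                       (Signed.∣m⇒∣m*n _ Signed.∣-refl)))
  where
  3∣Σ : + 3 ∣ˢ (a₁ * (u₁ - C * e₂ * e₃) + a₂ * (u₂ - C * e₁ * e₃) + a₃ * (u₃ - C * e₁ * e₂))
  3∣Σ = Signed.∣m∣n⇒∣m+n (Signed.∣m∣n⇒∣m+n (Signed.∣n⇒∣m*n a₁ b₁) (Signed.∣n⇒∣m*n a₂ b₂))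
                         (Signed.∣n⇒∣m*n a₃ b₃)

Balanced-resp-≈ : ∀ {u₁ u₂ u₃} C {x y z x′ y′ z′} → x ≈[ + 3 ] x′ → y ≈[ + 3 ] y′ → z ≈[ + 3 ] z′ →
  Balanced u₁ u₂ u₃ C x y z → Balanced u₁ u₂ u₃ C x′ y′ z′
Balanced-resp-≈ {u₁} {u₂} {u₃} C x≈ y≈ z≈ (b₁ , b₂ , b₃) =
  ∣-resp-≈ (≈-sym (relation u₁ y≈ z≈)) b₁ , ∣-resp-≈ (≈-sym (relation u₂ x≈ z≈)) b₂ ,
  ∣-resp-≈ (≈-sym (relation u₃ x≈ y≈)) b₃
  where
  relation : ∀ u {v v′ w w′} → v ≈[ + 3 ] v′ → w ≈[ + 3 ] w′ → u - C * v * w ≈[ + 3 ] u - C * v′ * w′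
  relation u v≈ w≈ = sub-cong (≈-refl u) (*-cong (*-cong (≈-refl C) v≈) w≈)

Balanced-units : ∀ {u₁ u₂ u₃} C {x y z} → ¬ (+ 3 ∣ˢ u₁) → ¬ (+ 3 ∣ˢ u₂) → Balanced u₁ u₂ u₃ C x y z →
  ¬ (+ 3 ∣ˢ x) × ¬ (+ 3 ∣ˢ y) × ¬ (+ 3 ∣ˢ z)
Balanced-units C {x} {y} {z} 3∤u₁ 3∤u₂ (b₁ , b₂ , _) =
  (λ 3∣x → 3∤u₂ (unit (Signed.∣m⇒∣m*n z (Signed.∣n⇒∣m*n C 3∣x)) b₂)) ,
  (λ 3∣y → 3∤u₁ (unit (Signed.∣m⇒∣m*n z (Signed.∣n⇒∣m*n C 3∣y)) b₁)) ,
  (λ 3∣z → 3∤u₁ (unit (Signed.∣n⇒∣m*n (C * y) 3∣z) b₁))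
  where
  unit : ∀ {u w} → + 3 ∣ˢ w → + 3 ∣ˢ (u - w) → + 3 ∣ˢ u
  unit {u} {w} 3∣w 3∣u-w = ∣-resp-≈ (mk≈ 3∣u-w) 3∣w

zero-mod-27-classification : ∀ {u₁ u₂ u₃ c} x y z → Admissible u₁ u₂ u₃ → + 3 ∣ˢ c →
  + 27 ∣ˢ cubicℤ u₁ u₂ u₃ c x y z → AllDivisibleBy3 x y z ⊎ SignConditionℤ u₁ u₂ u₃ c
zero-mod-27-classification {u₁} {u₂} {u₃} x y z adm@(3∤u₁ , 3∤u₂ , _) (divides C refl) 27∣F
  with zero-mod-9-classification C x y z adm (Signed.∣-trans 9∣27 27∣F)
... | inj₁ all-divisible = inj₁ all-divisible
... | inj₂ balanced with Balanced-units {u₁} {u₂} {u₃} C 3∤u₁ 3∤u₂ balanced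
... | 3∤x , 3∤y , 3∤z with unit-≈-sign 3∤x | unit-≈-sign 3∤y | unit-≈-sign 3∤z
... | e₁ , sign₁ , x≈e₁ | e₂ , sign₂ , y≈e₂ | e₃ , sign₃ , z≈e₃ =
  inj₂ (sign-condition-from-balanced sign₁ sign₂ sign₃ {u₁} {u₂} {u₃} C x≈e₁ y≈e₂ z≈e₃ 27∣F
          (Balanced-resp-≈ {u₁} {u₂} {u₃} C x≈e₁ y≈e₂ z≈e₃ balanced))

cubicℤ-homogeneous : ∀ a₁ a₂ a₃ c x y z t →
  cubicℤ a₁ a₂ a₃ c (x * t) (y * t) (z * t) ≡ t * t * t * cubicℤ a₁ a₂ a₃ c x y z
cubicℤ-homogeneous a₁ a₂ a₃ c x y z t = expand a₁ a₂ a₃ c x y z t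
  where
  expand : ∀ a₁ a₂ a₃ c x y z t →
    a₁ * (x * t * (x * t) * (x * t)) + a₂ * (y * t * (y * t) * (y * t)) + a₃ * (z * t * (z * t) * (z * t))
      - c * (x * t) * (y * t) * (z * t) ≡
    t * t * t * (a₁ * (x * x * x) + a₂ * (y * y * y) + a₃ * (z * z * z) - c * x * y * z)
  expand = solve-∀

descent : ∀ {u₁ u₂ u₃ c} → Admissible u₁ u₂ u₃ → + 3 ∣ˢ c → ¬ SignConditionℤ u₁ u₂ u₃ c →
  ∀ m {x y z} → 3^ (m ℕ.* 3) ∣ˢ cubicℤ u₁ u₂ u₃ c x y z → 3^ m ∣ˢ x × 3^ m ∣ˢ y × 3^ m ∣ˢ z
descent adm 3∣c ¬sc zero _ = 3^0∣ _ , 3^0∣ _ , 3^0∣ _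
descent adm 3∣c ¬sc (suc m) {x} {y} {z} 3^3m+3∣F
  with zero-mod-27-classification x y z adm 3∣c (Signed.∣-trans (3^-mono-∣ (ℕ.m≤m+n 3 (m ℕ.* 3))) 3^3m+3∣F)
... | inj₂ sc = ⊥-elim (¬sc sc)
descent {u₁} {u₂} {u₃} {c} adm 3∣c ¬sc (suc m) 3^3m+3∣F
  | inj₁ (divides x′ refl , divides y′ refl , divides z′ refl) =
  times3 (proj₁ smaller) , times3 (proj₁ (proj₂ smaller)) , times3 (proj₂ (proj₂ smaller))
  where
  smaller : 3^ m ∣ˢ x′ × 3^ m ∣ˢ y′ × 3^ m ∣ˢ z′
  smaller = descent adm 3∣c ¬sc m {x′} {y′} {z′} (Signed.*-cancelˡ-∣ (+ 27)
    (subst₂ _∣ˢ_ (3^-+ 3 (m ℕ.* 3)) (cubicℤ-homogeneous u₁ u₂ u₃ c x′ y′ z′ (+ 3)) 3^3m+3∣F))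
  times3 : ∀ {w} → 3^ m ∣ˢ w → 3^ suc m ∣ˢ w * + 3
  times3 3^m∣w = subst (_∣ˢ _) (trans (ℤ.*-comm (3^ m) (+ 3)) (sym (3^-suc m))) (Signed.*-monoˡ-∣ (+ 3) 3^m∣w)

AdmissibleAt : (Fin 3 → ℤ₃) → ℕ → Set
AdmissibleAt u k = Admissible (seq (u 0F) k) (seq (u 1F) k) (seq (u 2F) k)

AdmissibleAt-≤ : ∀ u {k} → 2 ≤ k → AdmissibleAt u 2 → AdmissibleAt u k
AdmissibleAt-≤ u 2≤k =
  Admissible-resp-≈ (≈-sym (seq-≈ (u 0F) 2≤k)) (≈-sym (seq-≈ (u 1F) 2≤k)) (≈-sym (seq-≈ (u 2F) 2≤k))

signs? : ∀ {P : ℤ → ℤ → Set} → (∀ s₁ s₂ → Dec (P s₁ s₂)) →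
  Dec (Σ ℤ λ s₁ → Σ ℤ λ s₂ → IsSign s₁ × IsSign s₂ × P s₁ s₂)
signs? {P} P? = map′ from to (P? 1ℤ 1ℤ ⊎-dec P? 1ℤ -1ℤ ⊎-dec P? -1ℤ 1ℤ ⊎-dec P? -1ℤ -1ℤ)
  where
  from : P 1ℤ 1ℤ ⊎ P 1ℤ -1ℤ ⊎ P -1ℤ 1ℤ ⊎ P -1ℤ -1ℤ →
         Σ ℤ λ s₁ → Σ ℤ λ s₂ → IsSign s₁ × IsSign s₂ × P s₁ s₂
  from (inj₁ p) = 1ℤ , 1ℤ , inj₁ refl , inj₁ refl , p
  from (inj₂ (inj₁ p)) = 1ℤ , -1ℤ , inj₁ refl , inj₂ refl , p
  from (inj₂ (inj₂ (inj₁ p))) = -1ℤ , 1ℤ , inj₂ refl , inj₁ refl , p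
  from (inj₂ (inj₂ (inj₂ p))) = -1ℤ , -1ℤ , inj₂ refl , inj₂ refl , p
  to : (Σ ℤ λ s₁ → Σ ℤ λ s₂ → IsSign s₁ × IsSign s₂ × P s₁ s₂) →
       P 1ℤ 1ℤ ⊎ P 1ℤ -1ℤ ⊎ P -1ℤ 1ℤ ⊎ P -1ℤ -1ℤ
  to (_ , _ , inj₁ refl , inj₁ refl , p) = inj₁ p
  to (_ , _ , inj₁ refl , inj₂ refl , p) = inj₂ (inj₁ p)
  to (_ , _ , inj₂ refl , inj₁ refl , p) = inj₂ (inj₂ (inj₁ p))
  to (_ , _ , inj₂ refl , inj₂ refl , p) = inj₂ (inj₂ (inj₂ p))

signDefect : (Fin 3 → ℤ₃) → ℤ₃ → ℕ → (s₁ s₂ : ℤ) → ℤ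
signDefect u c k s₁ s₂ = seq c k - (s₁ * seq (u 0F) k + s₂ * seq (u 1F) k + s₁ * s₂ * seq (u 2F) k)

sign-condition? : ∀ u c → Dec (SignCondition u c)
sign-condition? u c = signs? λ s₁ s₂ → map′ ∣⇒∣ᵤ ∣ᵤ⇒∣ (+ 27 ∣? signDefect u c 3 s₁ s₂)

SignCondition-from-level : ∀ u c {k} → 3 ≤ k →
  SignConditionℤ (seq (u 0F) k) (seq (u 1F) k) (seq (u 2F) k) (seq c k) → SignCondition u c
SignCondition-from-level u c {k} 3≤k (s₁ , s₂ , sign₁ , sign₂ , 27∣) =
  s₁ , s₂ , sign₁ , sign₂ , ∣⇒∣ᵤ {+ 27} {signDefect u c 3 s₁ s₂} (∣-resp-≈ (≈-sym levels) 27∣)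
  where
  levels : signDefect u c k s₁ s₂ ≈[ 3^ 3 ] signDefect u c 3 s₁ s₂
  levels = sub-cong (seq-≈ c 3≤k) (+-cong (+-cong (*-cong (≈-refl s₁) (seq-≈ (u 0F) 3≤k))
                                                  (*-cong (≈-refl s₂) (seq-≈ (u 1F) 3≤k)))
                                              (*-cong (≈-refl (s₁ * s₂)) (seq-≈ (u 2F) 3≤k)))

sign-condition-necessary : ∀ u c → AdmissibleAt u 2 → + 3 ∣ˢ seq c 1 →
  HasNontrivialSolution u c → SignCondition u c
sign-condition-necessary u c admissible 3∣c (X , Y , Z , solves , nontrivial) with sign-condition? u c
... | yes sc = sc
... | no ¬sc = ⊥-elim (nontrivial all-zero)
  where
  divisible : ∀ k → 3^ k ∣ˢ seq X k × 3^ k ∣ˢ seq Y k × 3^ k ∣ˢ seq Z k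
  divisible k =
    down X (proj₁ divisible-at-K) , down Y (proj₁ (proj₂ divisible-at-K)) ,
    down Z (proj₂ (proj₂ divisible-at-K))
    where
    K : ℕ
    K = suc k ℕ.* 3
    3≤K : 3 ≤ K
    3≤K = ℕ.m≤m+n 3 (k ℕ.* 3)
    divisible-at-K : 3^ suc k ∣ˢ seq X K × 3^ suc k ∣ˢ seq Y K × 3^ suc k ∣ˢ seq Z K
    divisible-at-K = descent (AdmissibleAt-≤ u (ℕ.≤-trans (ℕ.n≤1+n 2) 3≤K) admissible)
                             (∣-resp-≈ (seq-≈ c (ℕ.≤-trans (s≤s z≤n) 3≤K)) 3∣c)
                             (¬sc ∘ SignCondition-from-level u c 3≤K) (suc k) (∣ᵤ⇒∣ (solves K))
    down : (W : ℤ₃) → 3^ suc k ∣ˢ seq W K → 3^ k ∣ˢ seq W k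
    down W 3^k⁺¹∣W = ∣-resp-≈ (≈-sym (seq-≈ W (ℕ.≤-trans (ℕ.m≤m*n k 3) (ℕ.m≤n+m (k ℕ.* 3) 3))))
                              (Signed.∣-trans (3^-mono-∣ (ℕ.n≤1+n k)) 3^k⁺¹∣W)

  all-zero : IsZero₃ X × IsZero₃ Y × IsZero₃ Z
  all-zero = (λ k → ∣⇒∣ᵤ (proj₁ (divisible k))) , (λ k → ∣⇒∣ᵤ (proj₁ (proj₂ (divisible k)))) ,
             (λ k → ∣⇒∣ᵤ (proj₂ (proj₂ (divisible k))))

-- Sufficiency of the sign condition

SimpleRootMod3 : (a b d e s : ℤ) → Set
SimpleRootMod3 a b d e s = + 3 ∣ˢ cubicPoly a b d e s × ¬ (+ 3 ∣ˢ cubicPoly′ a b d s)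

HasSimpleRootMod3 : (a b d e : ℤ) → Set
HasSimpleRootMod3 a b d e = Σ (Fin 3) λ s → SimpleRootMod3 a b d e (toℤ s)

HasSimpleRootMod3-resp-≈ : ∀ {a b d e a′ b′ d′ e′} →
  a ≈[ + 3 ] a′ → b ≈[ + 3 ] b′ → d ≈[ + 3 ] d′ → e ≈[ + 3 ] e′ →
  HasSimpleRootMod3 a′ b′ d′ e′ → HasSimpleRootMod3 a b d e
HasSimpleRootMod3-resp-≈ a≈ b≈ d≈ e≈ (s , 3∣p , 3∤p′) =
  s , ∣-resp-≈ (cubicPoly-cong a≈ b≈ d≈ e≈ (≈-refl (toℤ s))) 3∣p ,
  3∤p′ ∘ ∣-resp-≈ (≈-sym (+-cong (+-cong d≈ (*-cong (*-cong (≈-refl (+ 2)) b≈) (≈-refl (toℤ s))))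
                                 (*-cong (*-cong (≈-refl (+ 3)) a≈) (≈-refl (toℤ s * toℤ s)))))

SimpleRootAmong : (a e d₀ d₁ d₂ : ℤ) → Set
SimpleRootAmong a e d₀ d₁ d₂ =
  HasSimpleRootMod3 a a d₀ e ⊎ HasSimpleRootMod3 a a d₁ e ⊎ HasSimpleRootMod3 a a d₂ e

opaque
  simple-root-table : ∀ (a e d₀ d₁ d₂ : Fin 3) → ¬ (+ 3 ∣ˢ toℤ a) →
    ¬ (+ 3 ∣ˢ (toℤ d₀ - toℤ d₁)) → ¬ (+ 3 ∣ˢ (toℤ d₀ - toℤ d₂)) → ¬ (+ 3 ∣ˢ (toℤ d₁ - toℤ d₂)) →
    SimpleRootAmong (toℤ a) (toℤ e) (toℤ d₀) (toℤ d₁) (toℤ d₂)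
  simple-root-table = toWitness {a? =
    Fin.all? λ a → Fin.all? λ e → Fin.all? λ d₀ → Fin.all? λ d₁ → Fin.all? λ d₂ →
    ¬? (+ 3 ∣? toℤ a) →-dec ¬? (+ 3 ∣? (toℤ d₀ - toℤ d₁)) →-dec ¬? (+ 3 ∣? (toℤ d₀ - toℤ d₂)) →-dec
    ¬? (+ 3 ∣? (toℤ d₁ - toℤ d₂)) →-dec
    (root? (toℤ a) (toℤ d₀) (toℤ e) ⊎-dec root? (toℤ a) (toℤ d₁) (toℤ e) ⊎-dec
     root? (toℤ a) (toℤ d₂) (toℤ e))} _
    where
    root? : ∀ a d e → Dec (HasSimpleRootMod3 a a d e)
    root? a d e = Fin.any? λ s → + 3 ∣? cubicPoly a a d e (toℤ s) ×-dec ¬? (+ 3 ∣? cubicPoly′ a a d (toℤ s))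

opaque
  simple-root-exists : ∀ {a e d₀ d₁ d₂} → ¬ (+ 3 ∣ˢ a) →
    ¬ (+ 3 ∣ˢ (d₀ - d₁)) → ¬ (+ 3 ∣ˢ (d₀ - d₂)) → ¬ (+ 3 ∣ˢ (d₁ - d₂)) → SimpleRootAmong a e d₀ d₁ d₂
  simple-root-exists {a} {e} {d₀} {d₁} {d₂} 3∤a 3∤d₀-d₁ 3∤d₀-d₂ 3∤d₁-d₂
    with residue 3 a | residue 3 e | residue 3 d₀ | residue 3 d₁ | residue 3 d₂
  ... | A , a≈ | E , e≈ | D₀ , d₀≈ | D₁ , d₁≈ | D₂ , d₂≈ =
    back (simple-root-table A E D₀ D₁ D₂ (3∤a ∘ ∣-resp-≈ a≈)
           (apart d₀≈ d₁≈ 3∤d₀-d₁) (apart d₀≈ d₂≈ 3∤d₀-d₂) (apart d₁≈ d₂≈ 3∤d₁-d₂))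
    where
    apart : ∀ {d d′ D D′} → d ≈[ + 3 ] D → d′ ≈[ + 3 ] D′ → ¬ (+ 3 ∣ˢ (d - d′)) → ¬ (+ 3 ∣ˢ (D - D′))
    apart d≈ d′≈ 3∤d-d′ = 3∤d-d′ ∘ ∣-resp-≈ (sub-cong d≈ d′≈)
    back : SimpleRootAmong (toℤ A) (toℤ E) (toℤ D₀) (toℤ D₁) (toℤ D₂) → SimpleRootAmong a e d₀ d₁ d₂
    back (inj₁ r) = inj₁ (HasSimpleRootMod3-resp-≈ a≈ a≈ d₀≈ e≈ r)
    back (inj₂ (inj₁ r)) = inj₂ (inj₁ (HasSimpleRootMod3-resp-≈ a≈ a≈ d₁≈ e≈ r))
    back (inj₂ (inj₂ r)) = inj₂ (inj₂ (HasSimpleRootMod3-resp-≈ a≈ a≈ d₂≈ e≈ r))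

solution-from-simple-root : ∀ u c {f g} s →
  cubicLevel u c 4 1ℤ 1ℤ 1ℤ ≡ f * + 27 → ∂ₓcubicLevel u c 4 1ℤ 1ℤ 1ℤ ≡ g * + 9 →
  SimpleRootMod3 (seq (u 0F) 4) (seq (u 0F) 4) g f s → HasNontrivialSolution u c
solution-from-simple-root u c {f} {g} s F≡27f ∂≡9g (3∣p , 3∤p′) =
  proj₁ lifted , const₃ 1ℤ , const₃ 1ℤ , proj₂ lifted ,
  λ (_ , y≡0 , _) → const₃-nonzero (toWitnessFalse {a? = + 3 ∣? 1ℤ} _) y≡0
  where
  open ≡-Reasoning
  a = seq (u 0F) 4
  x₀ = 1ℤ + + 3 * s
  higher = a * 1ℤ * (s * s) + a * (s * s * s)
  linear = + 2 * a * s + + 3 * a * (s * s)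

  F-value : cubicLevel u c 4 x₀ 1ℤ 1ℤ ≡ + 27 * cubicPoly a a g f s
  F-value = begin
    cubicLevel u c 4 x₀ 1ℤ 1ℤ
      ≡⟨ cubicℤ-taylorₓ a (seq (u 1F) 4) (seq (u 2F) 4) (seq c 4) 1ℤ 1ℤ 1ℤ s ⟩
    cubicLevel u c 4 1ℤ 1ℤ 1ℤ + + 3 * s * ∂ₓcubicLevel u c 4 1ℤ 1ℤ 1ℤ + + 27 * higher
      ≡⟨ cong₂ (λ F ∂ → F + + 3 * s * ∂ + + 27 * higher) F≡27f ∂≡9g ⟩
    f * + 27 + + 3 * s * (g * + 9) + + 27 * higher
      ≡⟨ collect f g a s ⟩
    + 27 * cubicPoly a a g f s ∎
    where
    collect : ∀ f g a s → f * + 27 + + 3 * s * (g * + 9) + + 27 * (a * 1ℤ * (s * s) + a * (s * s * s)) ≡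
                          + 27 * (f + g * s + a * (s * s) + a * (s * s * s))
    collect = solve-∀

  ∂-value : ∂ₓcubicLevel u c 4 x₀ 1ℤ 1ℤ ≡ + 9 * cubicPoly′ a a g s
  ∂-value = begin
    ∂ₓcubicLevel u c 4 x₀ 1ℤ 1ℤ                 ≡⟨ expand a (seq c 4) s ⟩
    ∂ₓcubicLevel u c 4 1ℤ 1ℤ 1ℤ + + 9 * linear  ≡⟨ cong (λ ∂ → ∂ + + 9 * linear) ∂≡9g ⟩
    g * + 9 + + 9 * linear                      ≡⟨ collect g a s ⟩
    + 9 * cubicPoly′ a a g s                    ∎
    where
    expand : ∀ a c s → + 3 * a * ((1ℤ + + 3 * s) * (1ℤ + + 3 * s)) - c * 1ℤ * 1ℤ ≡
                       (+ 3 * a * (1ℤ * 1ℤ) - c * 1ℤ * 1ℤ) + + 9 * (+ 2 * a * s + + 3 * a * (s * s))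
    expand = solve-∀
    collect : ∀ g a s → g * + 9 + + 9 * (+ 2 * a * s + + 3 * a * (s * s)) ≡
                        + 9 * (g + + 2 * a * s + + 3 * a * (s * s))
    collect = solve-∀

  lifted : Σ ℤ₃ λ X → IsSolution u c X (const₃ 1ℤ) (const₃ 1ℤ)
  lifted = lift-along-X u c 2 1ℤ refl x₀ 1ℤ 1ℤ
    (subst (3^ 4 ∣ˢ_) (sym F-value) (Signed.*-monoʳ-∣ (+ 27) 3∣p))
    (subst (3^ 2 ∣ˢ_) (sym ∂-value) (Signed.∣m⇒∣m*n _ Signed.∣-refl))
    (λ 27∣∂ → 3∤p′ (Signed.*-cancelˡ-∣ (+ 9) (subst (3^ 3 ∣ˢ_) ∂-value 27∣∂)))

MeanCongruent : (u₀ u₁ u₂ : ℤ) → Set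
MeanCongruent u₀ u₁ u₂ =
  + 9 ∣ˢ (+ 3 * u₀ - (u₀ + u₁ + u₂)) × + 9 ∣ˢ (+ 3 * u₁ - (u₀ + u₁ + u₂)) × + 9 ∣ˢ (+ 3 * u₂ - (u₀ + u₁ + u₂))

opaque
  mean-congruent-table : ∀ (U₀ U₁ U₂ : Fin 9) → Admissible (toℤ U₀) (toℤ U₁) (toℤ U₂) →
    + 3 ∣ˢ (toℤ U₀ + toℤ U₁ + toℤ U₂) → MeanCongruent (toℤ U₀) (toℤ U₁) (toℤ U₂)
  mean-congruent-table = toWitness {a? = Fin.all? λ U₀ → Fin.all? λ U₁ → Fin.all? λ U₂ →
    admissible? (toℤ U₀) (toℤ U₁) (toℤ U₂) →-dec (+ 3 ∣? (toℤ U₀ + toℤ U₁ + toℤ U₂)) →-dec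
    (+ 9 ∣? (+ 3 * toℤ U₀ - (toℤ U₀ + toℤ U₁ + toℤ U₂)) ×-dec
     + 9 ∣? (+ 3 * toℤ U₁ - (toℤ U₀ + toℤ U₁ + toℤ U₂)) ×-dec
     + 9 ∣? (+ 3 * toℤ U₂ - (toℤ U₀ + toℤ U₁ + toℤ U₂)))} _

opaque
  admissible-mean-congruent : ∀ {u₀ u₁ u₂} → Admissible u₀ u₁ u₂ → + 3 ∣ˢ (u₀ + u₁ + u₂) →
    MeanCongruent u₀ u₁ u₂
  admissible-mean-congruent {u₀} {u₁} {u₂} adm 3∣Σ with residue 9 u₀ | residue 9 u₁ | residue 9 u₂
  ... | U₀ , u₀≈ | U₁ , u₁≈ | U₂ , u₂≈ =
    back (mean-congruent-table U₀ U₁ U₂ (Admissible-resp-≈ u₀≈ u₁≈ u₂≈ adm)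
                               (∣-resp-≈ (≈-sym (≈-weaken 3∣9 Σ≈)) 3∣Σ))
    where
    Σ≈ : u₀ + u₁ + u₂ ≈[ + 9 ] toℤ U₀ + toℤ U₁ + toℤ U₂
    Σ≈ = +-cong (+-cong u₀≈ u₁≈) u₂≈
    third : ∀ {u} {U : Fin 9} → u ≈[ + 9 ] toℤ U →
            + 3 * u - (u₀ + u₁ + u₂) ≈[ + 9 ] + 3 * toℤ U - (toℤ U₀ + toℤ U₁ + toℤ U₂)
    third u≈ = sub-cong (*-cong (≈-refl (+ 3)) u≈) Σ≈
    back : MeanCongruent (toℤ U₀) (toℤ U₁) (toℤ U₂) → MeanCongruent u₀ u₁ u₂
    back (d₀ , d₁ , d₂) = ∣-resp-≈ (third u₀≈) d₀ , ∣-resp-≈ (third u₁≈) d₁ , ∣-resp-≈ (third u₂≈) d₂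

solution-from-zero-at-ones : ∀ u c → AdmissibleAt u 2 → + 3 ∣ˢ seq c 1 →
  + 27 ∣ˢ cubicLevel u c 3 1ℤ 1ℤ 1ℤ → HasNontrivialSolution u c
solution-from-zero-at-ones u c admissible₂ 3∣c₁ 27∣F₃ =
  choose-coordinate (simple-root-exists {U 0F} {f} {g 0F} {g 1F} {g 2F} 3∤U₀
                       (apart 0F 1F ¬pm₀₁) (apart 0F 2F ¬pm₀₂) (apart 1F 2F ¬pm₁₂))
  where
  U : Fin 3 → ℤ
  U i = seq (u i) 4
  C sum : ℤ
  C = seq c 4
  sum = U 0F + U 1F + U 2F
  F = cubicLevel u c 4 1ℤ 1ℤ 1ℤ

  admissible : AdmissibleAt u 4
  admissible = AdmissibleAt-≤ u (s≤s (s≤s z≤n)) admissible₂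
  3∤U₀ : ¬ (+ 3 ∣ˢ U 0F)
  3∤U₀ = proj₁ admissible
  ¬pm₀₁ : ¬ PlusMinus9 (U 0F) (U 1F)
  ¬pm₀₁ = proj₁ (proj₂ (proj₂ (proj₂ admissible)))
  ¬pm₀₂ : ¬ PlusMinus9 (U 0F) (U 2F)
  ¬pm₀₂ = proj₁ (proj₂ (proj₂ (proj₂ (proj₂ admissible))))
  ¬pm₁₂ : ¬ PlusMinus9 (U 1F) (U 2F)
  ¬pm₁₂ = proj₂ (proj₂ (proj₂ (proj₂ (proj₂ admissible))))

  F≡sum-C : F ≡ sum - C
  F≡sum-C = expand (U 0F) (U 1F) (U 2F) C
    where
    expand : ∀ a b d c →
      a * (1ℤ * 1ℤ * 1ℤ) + b * (1ℤ * 1ℤ * 1ℤ) + d * (1ℤ * 1ℤ * 1ℤ) - c * 1ℤ * 1ℤ * 1ℤ ≡ a + b + d - c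
    expand = solve-∀

  27∣sum-C : + 27 ∣ˢ (sum - C)
  27∣sum-C = subst (+ 27 ∣ˢ_) F≡sum-C
    (∣-resp-≈ (coherent-≤ (cubicLevel-coherent u c 1ℤ 1ℤ 1ℤ) (s≤s (s≤s (s≤s z≤n)))) 27∣F₃)

  mean-congruent : MeanCongruent (U 0F) (U 1F) (U 2F)
  mean-congruent = admissible-mean-congruent admissible
    (subst (+ 3 ∣ˢ_) (lemma sum C)
      (Signed.∣m∣n⇒∣m+n (Signed.∣-trans 3∣27 27∣sum-C) (∣-resp-≈ (seq-≈ c (s≤s z≤n)) 3∣c₁)))
    where
    lemma : ∀ s c → s - c + c ≡ s
    lemma = solve-∀

  ∂ : Fin 3 → ℤ
  ∂ i = ∂ₓcubicℤ (U i) C 1ℤ 1ℤ 1ℤ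

  9∣∂ : ∀ i → + 9 ∣ˢ ∂ i
  9∣∂ i = subst (+ 9 ∣ˢ_) (sym (split (U i) sum C))
                (Signed.∣m∣n⇒∣m+n (third i) (Signed.∣-trans 9∣27 27∣sum-C))
    where
    split : ∀ a s c → + 3 * a * (1ℤ * 1ℤ) - c * 1ℤ * 1ℤ ≡ (+ 3 * a - s) + (s - c)
    split = solve-∀
    third : ∀ i → + 9 ∣ˢ (+ 3 * U i - sum)
    third 0F = proj₁ mean-congruent
    third 1F = proj₁ (proj₂ mean-congruent)
    third 2F = proj₂ (proj₂ mean-congruent)

  f : ℤ
  f = Signed._∣_.quotient 27∣sum-C
  g : Fin 3 → ℤ
  g i = Signed._∣_.quotient (9∣∂ i)
  F≡27f : F ≡ f * + 27
  F≡27f = trans F≡sum-C (Signed._∣_.equality 27∣sum-C)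
  ∂≡9g : ∀ i → ∂ i ≡ g i * + 9
  ∂≡9g i = Signed._∣_.equality (9∣∂ i)

  ∂-difference : ∀ i j → ∂ i - ∂ j ≡ (U i - U j) * + 3
  ∂-difference i j = difference (U i) (U j) C
    where
    difference : ∀ a b c →
      (+ 3 * a * (1ℤ * 1ℤ) - c * 1ℤ * 1ℤ) - (+ 3 * b * (1ℤ * 1ℤ) - c * 1ℤ * 1ℤ) ≡ (a - b) * + 3
    difference = solve-∀

  g-difference : ∀ i j → (g i - g j) * + 9 ≡ (U i - U j) * + 3
  g-difference i j = begin
    (g i - g j) * + 9        ≡⟨ distrib (g i) (g j) ⟩
    g i * + 9 - g j * + 9    ≡⟨ cong₂ _-_ (sym (∂≡9g i)) (sym (∂≡9g j)) ⟩
    ∂ i - ∂ j                ≡⟨ ∂-difference i j ⟩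
    (U i - U j) * + 3        ∎
    where
    open ≡-Reasoning
    distrib : ∀ a b → (a - b) * + 9 ≡ a * + 9 - b * + 9
    distrib = solve-∀

  apart : ∀ i j → ¬ PlusMinus9 (U i) (U j) → ¬ (+ 3 ∣ˢ (g i - g j))
  apart i j ¬pm 3∣gᵢ-gⱼ =
    ¬pm (inj₁ (Signed.*-cancelʳ-∣ (+ 3)
      (subst (+ 27 ∣ˢ_) (g-difference i j) (Signed.*-monoˡ-∣ (+ 9) 3∣gᵢ-gⱼ))))

  U≈U₀ : ∀ i → U i ≈[ + 3 ] U 0F
  U≈U₀ i = mk≈ (Signed.*-cancelʳ-∣ (+ 3)
    (subst (+ 9 ∣ˢ_) (∂-difference i 0F) (Signed.∣m∣n⇒∣m-n (9∣∂ i) (9∣∂ 0F))))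

  relocate : ∀ i → HasSimpleRootMod3 (U 0F) (U 0F) (g i) f → HasSimpleRootMod3 (U i) (U i) (g i) f
  relocate i = HasSimpleRootMod3-resp-≈ (U≈U₀ i) (U≈U₀ i) (≈-refl (g i)) (≈-refl f)

  choose-coordinate : SimpleRootAmong (U 0F) f (g 0F) (g 1F) (g 2F) → HasNontrivialSolution u c
  choose-coordinate (inj₁ (s , root)) =
    solution-from-simple-root u c {f} {g 0F} (toℤ s) F≡27f (∂≡9g 0F) root
  choose-coordinate (inj₂ (inj₁ root₁)) =
    let s , root = relocate 1F root₁ in
    σ₀₁-solution u c (solution-from-simple-root (u ∘ σ₀₁) c {f} {g 1F} (toℤ s)
                        (trans (swap (U 1F) (U 0F) (U 2F) C) F≡27f) (∂≡9g 1F) root)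
    where
    swap : ∀ a b d c → a * (1ℤ * 1ℤ * 1ℤ) + b * (1ℤ * 1ℤ * 1ℤ) + d * (1ℤ * 1ℤ * 1ℤ) - c * 1ℤ * 1ℤ * 1ℤ ≡
                       b * (1ℤ * 1ℤ * 1ℤ) + a * (1ℤ * 1ℤ * 1ℤ) + d * (1ℤ * 1ℤ * 1ℤ) - c * 1ℤ * 1ℤ * 1ℤ
    swap = solve-∀
  choose-coordinate (inj₂ (inj₂ root₂)) =
    let s , root = relocate 2F root₂ in
    σ₀₂-solution u c (solution-from-simple-root (u ∘ σ₀₂) c {f} {g 2F} (toℤ s)
                        (trans (swap (U 2F) (U 1F) (U 0F) C) F≡27f) (∂≡9g 2F) root)
    where
    swap : ∀ a b d c → a * (1ℤ * 1ℤ * 1ℤ) + b * (1ℤ * 1ℤ * 1ℤ) + d * (1ℤ * 1ℤ * 1ℤ) - c * 1ℤ * 1ℤ * 1ℤ ≡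
                       d * (1ℤ * 1ℤ * 1ℤ) + b * (1ℤ * 1ℤ * 1ℤ) + a * (1ℤ * 1ℤ * 1ℤ) - c * 1ℤ * 1ℤ * 1ℤ
    swap = solve-∀

_≡±_ : ℤ → ℤ → Set
a′ ≡± a = a′ ≡ a ⊎ a′ ≡ - a

∣-± : ∀ {n a a′} → a′ ≡± a → n ∣ˢ a′ → n ∣ˢ a
∣-± (inj₁ refl) n∣a = n∣a
∣-± {n} {a} (inj₂ refl) n∣-a = subst (n ∣ˢ_) (ℤ.neg-involutive a) (Signed.∣m⇒∣-m n∣-a)

PlusMinus9-negˡ : ∀ {a b} → PlusMinus9 (- a) b → PlusMinus9 a b
PlusMinus9-negˡ {a} {b} (inj₁ 9∣-a-b) = inj₂ (subst (+ 9 ∣ˢ_) (lemma a b) (Signed.∣m⇒∣-m 9∣-a-b))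
  where
  lemma : ∀ a b → - (- a - b) ≡ a + b
  lemma = solve-∀
PlusMinus9-negˡ {a} {b} (inj₂ 9∣-a+b) = inj₁ (subst (+ 9 ∣ˢ_) (lemma a b) (Signed.∣m⇒∣-m 9∣-a+b))
  where
  lemma : ∀ a b → - (- a + b) ≡ a - b
  lemma = solve-∀

PlusMinus9-negʳ : ∀ {a b} → PlusMinus9 a (- b) → PlusMinus9 a b
PlusMinus9-negʳ {a} {b} (inj₁ 9∣a+b) = inj₂ (subst (+ 9 ∣ˢ_) (lemma a b) 9∣a+b)
  where
  lemma : ∀ a b → a - - b ≡ a + b
  lemma = solve-∀
PlusMinus9-negʳ (inj₂ 9∣a-b) = inj₁ 9∣a-b

PlusMinus9-± : ∀ {a b a′ b′} → a′ ≡± a → b′ ≡± b → PlusMinus9 a′ b′ → PlusMinus9 a b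
PlusMinus9-± (inj₁ refl) (inj₁ refl) = id
PlusMinus9-± {a} {b} (inj₁ refl) (inj₂ refl) = PlusMinus9-negʳ {a} {b}
PlusMinus9-± {a} {b} (inj₂ refl) (inj₁ refl) = PlusMinus9-negˡ {a} {b}
PlusMinus9-± {a} {b} (inj₂ refl) (inj₂ refl) = PlusMinus9-negˡ {a} {b} ∘ PlusMinus9-negʳ { - a} {b}

Admissible-± : ∀ {u₁ u₂ u₃ v₁ v₂ v₃} → v₁ ≡± u₁ → v₂ ≡± u₂ → v₃ ≡± u₃ →
  Admissible u₁ u₂ u₃ → Admissible v₁ v₂ v₃
Admissible-± v₁± v₂± v₃± (3∤u₁ , 3∤u₂ , 3∤u₃ , ¬pm₁₂ , ¬pm₁₃ , ¬pm₂₃) =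
  3∤u₁ ∘ ∣-± v₁± , 3∤u₂ ∘ ∣-± v₂± , 3∤u₃ ∘ ∣-± v₃± ,
  ¬pm₁₂ ∘ PlusMinus9-± v₁± v₂± , ¬pm₁₃ ∘ PlusMinus9-± v₁± v₃± , ¬pm₂₃ ∘ PlusMinus9-± v₂± v₃±

solution-from-sign-condition : ∀ u c → AdmissibleAt u 2 → + 3 ∣ˢ seq c 1 →
  SignCondition u c → HasNontrivialSolution u c
solution-from-sign-condition u c admissible 3∣c (_ , _ , inj₁ refl , inj₁ refl , 27∣defect) =
  solution-from-zero-at-ones u c admissible 3∣c
    (subst (+ 27 ∣ˢ_) (value (seq (u 0F) 3) (seq (u 1F) 3) (seq (u 2F) 3) (seq c 3))
      (Signed.∣m⇒∣-m (∣ᵤ⇒∣ 27∣defect)))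
  where
  value : ∀ a b d c → - (c - (1ℤ * a + 1ℤ * b + 1ℤ * 1ℤ * d)) ≡
                      a * (1ℤ * 1ℤ * 1ℤ) + b * (1ℤ * 1ℤ * 1ℤ) + d * (1ℤ * 1ℤ * 1ℤ) - c * 1ℤ * 1ℤ * 1ℤ
  value = solve-∀
solution-from-sign-condition u c admissible 3∣c (_ , _ , inj₁ refl , inj₂ refl , 27∣defect) =
  neg₁₂-solution u c (solution-from-zero-at-ones (neg₁₂ u) c
    (Admissible-± (inj₁ refl) (inj₂ refl) (inj₂ refl) admissible) 3∣c
    (subst (+ 27 ∣ˢ_) (value (seq (u 0F) 3) (seq (u 1F) 3) (seq (u 2F) 3) (seq c 3))
      (Signed.∣m⇒∣-m (∣ᵤ⇒∣ 27∣defect))))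
  where
  value : ∀ a b d c → - (c - (1ℤ * a + -1ℤ * b + 1ℤ * -1ℤ * d)) ≡
                      a * (1ℤ * 1ℤ * 1ℤ) + - b * (1ℤ * 1ℤ * 1ℤ) + - d * (1ℤ * 1ℤ * 1ℤ) - c * 1ℤ * 1ℤ * 1ℤ
  value = solve-∀
solution-from-sign-condition u c admissible 3∣c (_ , _ , inj₂ refl , inj₁ refl , 27∣defect) =
  neg₁-solution u c (solution-from-zero-at-ones (neg₁ u) (neg₃ c)
    (Admissible-± (inj₁ refl) (inj₂ refl) (inj₁ refl) admissible) (Signed.∣m⇒∣-m 3∣c)
    (subst (+ 27 ∣ˢ_) (value (seq (u 0F) 3) (seq (u 1F) 3) (seq (u 2F) 3) (seq c 3)) (∣ᵤ⇒∣ 27∣defect)))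
  where
  value : ∀ a b d c → c - (-1ℤ * a + 1ℤ * b + -1ℤ * 1ℤ * d) ≡
                      a * (1ℤ * 1ℤ * 1ℤ) + - b * (1ℤ * 1ℤ * 1ℤ) + d * (1ℤ * 1ℤ * 1ℤ) - - c * 1ℤ * 1ℤ * 1ℤ
  value = solve-∀
solution-from-sign-condition u c admissible 3∣c (_ , _ , inj₂ refl , inj₂ refl , 27∣defect) =
  neg₂-solution u c (solution-from-zero-at-ones (neg₂ u) (neg₃ c)
    (Admissible-± (inj₁ refl) (inj₁ refl) (inj₂ refl) admissible) (Signed.∣m⇒∣-m 3∣c)
    (subst (+ 27 ∣ˢ_) (value (seq (u 0F) 3) (seq (u 1F) 3) (seq (u 2F) 3) (seq c 3)) (∣ᵤ⇒∣ 27∣defect)))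
  where
  value : ∀ a b d c → c - (-1ℤ * a + -1ℤ * b + -1ℤ * -1ℤ * d) ≡
                      a * (1ℤ * 1ℤ * 1ℤ) + b * (1ℤ * 1ℤ * 1ℤ) + - d * (1ℤ * 1ℤ * 1ℤ) - - c * 1ℤ * 1ℤ * 1ℤ
  value = solve-∀

lemma5p10 : (u : Fin 3 → ℤ₃) (c : ℤ₃) →
  (+ 3) ∣ seq c 1 →
  ¬ ((+ 3) ∣ (seq (u zero) 1 * seq (u (suc zero)) 1 * seq (u (suc (suc zero))) 1)) →
  ((Σ (Fin 3) λ i → Σ (Fin 3) λ j → i ≢ j × PlusMinusMod9 u i j) →
    HasNontrivialSolution u c)
  × ((∀ i j → i ≢ j → ¬ PlusMinusMod9 u i j) →
    (HasNontrivialSolution u c → SignCondition u c)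
    × (SignCondition u c → HasNontrivialSolution u c))
lemma5p10 u c 3∣c 3∤u₀u₁u₂ =
  solution-from-PlusMinusMod9 u c units ,
  λ ¬pm → sign-condition-necessary u c (admissible ¬pm) (∣ᵤ⇒∣ 3∣c) ,
          solution-from-sign-condition u c (admissible ¬pm) (∣ᵤ⇒∣ 3∣c)
  where
  units : ∀ i → ¬ (+ 3 ∣ˢ seq (u i) 1)
  units 0F 3∣u₀ = 3∤u₀u₁u₂ (∣⇒∣ᵤ (Signed.∣m⇒∣m*n (seq (u 2F) 1) (Signed.∣m⇒∣m*n (seq (u 1F) 1) 3∣u₀)))
  units 1F 3∣u₁ = 3∤u₀u₁u₂ (∣⇒∣ᵤ (Signed.∣m⇒∣m*n (seq (u 2F) 1) (Signed.∣n⇒∣m*n (seq (u 0F) 1) 3∣u₁)))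
  units 2F 3∣u₂ = 3∤u₀u₁u₂ (∣⇒∣ᵤ (Signed.∣n⇒∣m*n (seq (u 0F) 1 * seq (u 1F) 1) 3∣u₂))

  admissible : (∀ i j → i ≢ j → ¬ PlusMinusMod9 u i j) → AdmissibleAt u 2
  admissible ¬pm =
    unit 0F , unit 1F , unit 2F , apart 0F 1F (λ ()) , apart 0F 2F (λ ()) , apart 1F 2F (λ ())
    where
    unit : ∀ i → ¬ (+ 3 ∣ˢ seq (u i) 2)
    unit i = unit-at-level (u i) (units i) (s≤s z≤n)
    apart : ∀ i j → i ≢ j → ¬ PlusMinus9 (seq (u i) 2) (seq (u j) 2)
    apart i j i≢j = ¬pm i j i≢j ∘ Data.Sum.map ∣⇒∣ᵤ ∣⇒∣ᵤ
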